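{- For every function $f:\mathbb N\to\mathbb N$ there exist a finite configuration $A\subseteq\mathbb N^n$ and a Markov basis $M$ of $I_A$ such that $\deg_{Gr_A}>f(\deg_M)$, $\deg_{\mathcal U_A}>f(\deg_M)$ and $\deg_{\mathcal C_A}>f(\deg_M)$. That is, the degrees of the elements of the Graver basis, of the universal Gröbner basis and of the circuits of a toric ideal cannot be bounded above by any function of the maximal degree of the elements of a Markov basis.
   Context: Let $\mathbb K$ be a field and $A=\{\mathbf a_1,\dots,\mathbf a_m\}\subseteq\mathbb Z^n$ finite. For $\mathbf u\in\mathbb N^m$, $\mathbf x^{\mathbf u}=x_1^{u_1}\cdots x_m^{u_m}$ has degree $u_1+\dots+u_m$ and $A$-degree $\sum u_i\mathbf a_i$. The toric ideal $I_A\subseteq\mathbb K[x_1,\dots,x_m]$ is generated by all binomials $\mathbf x^{\mathbf u}-\mathbf x^{\mathbf v}$ of equal $A$-degree. The degree of a binomial is the maximum of the degrees of its two monomials. $Gr_A$ (Graver basis) is the set of primitive binomials: irreducible binomials $\mathbf x^{\mathbf u}-\mathbf x^{\mathbf v}\in I_A$ such that no other binomial $\mathbf x^{\mathbf w}-\mathbf x^{\mathbf z}\in I_A$ has $\mathbf x^{\mathbf w}\mid\mathbf x^{\mathbf u}$, $\mathbf x^{\mathbf z}\mid\mathbf x^{\mathbf v}$. $\mathcal U_A$ is the union of all reduced Gröbner bases of $I_A$. $\mathcal C_A$ is the set of circuits (irreducible nonzero binomials of $I_A$ of minimal support). A Markov basis is a generating set of $I_A$ of binomials minimal under inclusion. For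 a finite set $S$ of binomials, $\deg_S$ is the maximal degree of its elements. -}

module Defs where

open import Level using (Level; _⊔_; suc)
open import Data.Nat as ℕ using (ℕ; zero; _<_; _≤_)
open import Data.Fin using (Fin)
open import Data.Vec as Vec using (Vec; []; _∷_; lookup; zipWith; replicate; foldr)
open import Data.Vec.Properties using (≡-dec)
open import Data.List as List using (List; []; _∷_; _++_; concatMap)
open import Data.List.Membership.Propositional using (_∈_)
open import Data.Product using (Σ; ∃; ∃-syntax; _×_; _,_; proj₁; proj₂)
open import Data.Sum using (_⊎_)
open import Relation.Nullary using (¬_; yes; no)
open import Relation.Binary.PropositionalEquality using (_≡_)
open import Relation.Binary.Structures using (IsTotalOrder)
open import Algebra.Bundles using (CommutativeRing)

record Field (c ℓ : Level) : Set (Level.suc (c Level.⊔ ℓ)) where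
  field
    commRing : CommutativeRing c ℓ
  open CommutativeRing commRing public
  field
    1≉0     : ¬ (1# ≈ 0#)
    inverse : ∀ x → ¬ (x ≈ 0#) → ∃[ y ] (x * y ≈ 1#)

Mon : ℕ → Set
Mon m = Vec ℕ m

deg : ∀ {m} → Mon m → ℕ
deg = foldr (λ _ → ℕ) ℕ._+_ 0

_+ᵥ_ : ∀ {k} → Vec ℕ k → Vec ℕ k → Vec ℕ k
_+ᵥ_ = zipWith ℕ._+_

-- componentwise order: x^w ∣ x^u  iff  w ≤ u componentwise
_∣ₘ_ : ∀ {m} → Mon m → Mon m → Set
w ∣ₘ u = ∀ i → lookup w i ≤ lookup u i

-- A configuration A = {a₁,…,aₘ} ⊆ ℕⁿ, given as the list of its m points
Config : ℕ → ℕ → Set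
Config n m = Vec (Vec ℕ n) m

adeg : ∀ {n m} → Config n m → Mon m → Vec ℕ n
adeg [] [] = replicate _ 0
adeg (a ∷ A) (u ∷ us) = Vec.map (u ℕ.*_) a +ᵥ adeg A us

-- a binomial x^u - x^v, represented by its pair of exponent vectors
Binom : ℕ → Set
Binom m = Mon m × Mon m

degB : ∀ {m} → Binom m → ℕ
degB (u , v) = deg u ℕ.⊔ deg v

degS : ∀ {m} → List (Binom m) → ℕ
degS = List.foldr (λ b k → degB b ℕ.⊔ k) 0

InSupp : ∀ {m} → Binom m → Fin m → Set
InSupp (u , v) i = ¬ (lookup u i ≡ 0) ⊎ ¬ (lookup v i ≡ 0)

-- irreducible: gcd(x^u, x^v) = 1
Irreducible : ∀ {m} → Binom m → Set
Irreducible (u , v) = ∀ i → lookup u i ≡ 0 ⊎ lookup v i ≡ 0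

NonzeroB : ∀ {m} → Binom m → Set
NonzeroB (u , v) = ¬ (u ≡ v)

-- Polynomials over a field K in m variables, as finite formal sums of
-- terms c·x^u; two polynomials are equal when all coefficients agree.

module Polynomials {c ℓ} (K : Field c ℓ) (m : ℕ) where
  open Field K

  Poly : Set c
  Poly = List (Carrier × Mon m)

  coeff : Poly → Mon m → Carrier
  coeff [] u = 0#
  coeff ((a , w) ∷ p) u with ≡-dec ℕ._≟_ w u
  ... | yes _ = a + coeff p u
  ... | no  _ = coeff p u

  _≈ₚ_ : Poly → Poly → Set ℓ
  p ≈ₚ q = ∀ u → coeff p u ≈ coeff q u

  _*ₚ_ : Poly → Poly → Poly
  p *ₚ q = concatMap (λ { (a , u) → List.map (λ { (b , v) → (a * b , u +ᵥ v) }) q }) p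

  binom : Binom m → Poly
  binom (u , v) = (1# , u) ∷ (- 1# , v) ∷ []

  InIdeal : ∀ {s} → (Binom m → Set s) → Poly → Set (c ⊔ ℓ ⊔ s)
  InIdeal S f =
    ∃[ gs ] ((∀ {g b} → (g , b) ∈ gs → S b)
            × f ≈ₚ List.foldr (λ { (g , b) h → (g *ₚ binom b) ++ h }) [] gs)

  NonzeroP : Poly → Set ℓ
  NonzeroP f = ¬ (∀ u → coeff f u ≈ 0#)

  module Toric {n} (A : Config n m) where

    SameADeg : Binom m → Set
    SameADeg (u , v) = adeg A u ≡ adeg A v

    InIA : Poly → Set (c ⊔ ℓ)
    InIA = InIdeal SameADeg

    BinInIA : Binom m → Set (c ⊔ ℓ)
    BinInIA b = InIA (binom b)

    Generates : List (Binom m) → Set (c ⊔ ℓ)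
    Generates M = (∀ {b} → b ∈ M → BinInIA b)
                × (∀ f → InIA f → InIdeal (_∈ M) f)

    IsMarkovBasis : List (Binom m) → Set (c ⊔ ℓ)
    IsMarkovBasis M = Generates M
      × (∀ M' → (∀ {b} → b ∈ M' → b ∈ M) → Generates M' → ∀ {b} → b ∈ M → b ∈ M')

    IsPrimitive : Binom m → Set (c ⊔ ℓ)
    IsPrimitive (u , v) = BinInIA (u , v) × Irreducible (u , v) × NonzeroB (u , v)
      × (∀ w z → BinInIA (w , z) → NonzeroB (w , z) → w ∣ₘ u → z ∣ₘ v
           → (w , z) ≡ (u , v))

    IsCircuit : Binom m → Set (c ⊔ ℓ)
    IsCircuit b = BinInIA b × Irreducible b × NonzeroB b
      × (∀ b' → BinInIA b' → Irreducible b' → NonzeroB b'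
           → (∀ i → InSupp b' i → InSupp b i)
           → ∀ i → InSupp b i → InSupp b' i)

    record TermOrder : Set₁ where
      field
        _≼_        : Mon m → Mon m → Set
        isTotal    : IsTotalOrder _≡_ _≼_
        compatible : ∀ u v w → u ≼ v → (u +ᵥ w) ≼ (v +ᵥ w)
        one-least  : ∀ u → replicate m 0 ≼ u

    module _ (≺ : TermOrder) where
      open TermOrder ≺

      IsInit : Poly → Mon m → Set ℓ
      IsInit f u = ¬ (coeff f u ≈ 0#) × (∀ v → ¬ (coeff f v ≈ 0#) → v ≼ u)

      IsReducedGB : List Poly → Set (c ⊔ ℓ)
      IsReducedGB G =
          (∀ {g} → g ∈ G → InIA g)
        × (∀ {g} → g ∈ G → ∃[ u ] IsInit g u)
        × (∀ f u → InIA f → IsInit f u →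
             ∃[ i ] ∃[ w ] (IsInit (List.lookup G i) w × w ∣ₘ u))
        × (∀ i u → IsInit (List.lookup G i) u → coeff (List.lookup G i) u ≈ 1#)
        × (∀ i j u w → ¬ (i ≡ j) → IsInit (List.lookup G i) u
             → ¬ (coeff (List.lookup G j) w ≈ 0#) → ¬ (u ∣ₘ w))

    InUniversalGB : Poly → Set (Level.suc Level.zero ⊔ c ⊔ ℓ)
    InUniversalGB g = ∃[ ≺ ] ∃[ G ] (IsReducedGB ≺ G × g ∈ G)

  DegPolyGT : Poly → ℕ → Set ℓ
  DegPolyGT f k = ∃[ u ] (¬ (coeff f u ≈ 0#) × k < deg u)

module _ {c ℓ} (K : Field c ℓ) {n m : ℕ} (A : Config n m) where
  open Polynomials K m
  open Toric A

  MarkovBasis : List (Binom m) → Set (c ⊔ ℓ)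
  MarkovBasis = IsMarkovBasis

  GraverElem : Binom m → Set (c ⊔ ℓ)
  GraverElem = IsPrimitive

  CircuitElem : Binom m → Set (c ⊔ ℓ)
  CircuitElem = IsCircuit

  DegGraverGT : ℕ → Set (c ⊔ ℓ)
  DegGraverGT k = ∃[ b ] (IsPrimitive b × k < degB b)

  DegCircuitsGT : ℕ → Set (c ⊔ ℓ)
  DegCircuitsGT k = ∃[ b ] (IsCircuit b × k < degB b)

  DegUniversalGT : ℕ → Set (Level.suc Level.zero ⊔ c ⊔ ℓ)
  DegUniversalGT k = ∃[ g ] (InUniversalGB g × DegPolyGT g k)

module Submission where

open import Defs
open import Level using (Level)
open import Data.Nat using (ℕ)
open import Data.Fin using (Fin)
open import Data.Vec using (lookup)
open import Data.List using (List)
open import Data.Product using (Σ; ∃; ∃-syntax; _×_)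
open import Relation.Binary.PropositionalEquality using (_≡_)

-- Witness: A_K = {2^K, …, 2, 1} ⊆ ℕ¹ with K = f 2 + 1, variables x₀, …, x_K.
-- The moves x_(i+1)² − xᵢ form a Markov basis of degree 2: every monomial is
-- joined by moves to a normal form whose later exponents are binary, and
-- that normal form is determined by the A-degree; the moves are minimal
-- because xᵢ occurs in no multiple of any other move.  The binomial
-- x₀ − x_K^(2^K) of degree 2^K > f 2 is primitive, a circuit, and lies in
-- the reduced lexicographic Gröbner basis {xᵢ − x_K^(2^(K−i))}.

module Monomials where
  open import Data.Nat using (zero; suc; _+_; _⊔_; _≤_; z≤n)
  open import Data.Nat.Properties
    using (+-assoc; +-identityˡ; +-identityʳ; n≤0⇒n≡0; ⊔-identityʳ; ⊔-idem; +-commutativeSemigroup)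
  open import Algebra.Properties.CommutativeSemigroup +-commutativeSemigroup
    using () renaming (interchange to +-interchange)
  open import Data.Fin using (zero; suc)
  import Data.Fin.Properties as Fin
  open import Data.Vec using ([]; _∷_; replicate)
  open import Data.Vec.Properties
    using (tabulate∘lookup; tabulate-cong; lookup-zipWith; lookup-replicate;
           zipWith-assoc; zipWith-identityˡ; zipWith-identityʳ)
  open import Data.List using (tabulate)
  open import Data.Product using (_,_)
  open import Data.Empty using (⊥-elim)
  open import Function using (_∘_)
  open import Relation.Nullary using (¬_; yes; no)
  open import Relation.Binary.PropositionalEquality using (refl; sym; trans; cong; cong₂; subst)

  one : ∀ {k} → Mon k
  one = replicate _ 0

  +ᵥ-assoc : ∀ {k} (u v w : Mon k) → (u +ᵥ v) +ᵥ w ≡ u +ᵥ (v +ᵥ w)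
  +ᵥ-assoc = zipWith-assoc +-assoc

  +ᵥ-identityˡ : ∀ {k} (u : Mon k) → one +ᵥ u ≡ u
  +ᵥ-identityˡ = zipWith-identityˡ +-identityˡ

  +ᵥ-identityʳ : ∀ {k} (u : Mon k) → u +ᵥ one ≡ u
  +ᵥ-identityʳ = zipWith-identityʳ +-identityʳ

  +ᵥ-interchange : ∀ {k} (u v w x : Mon k) → (u +ᵥ v) +ᵥ (w +ᵥ x) ≡ (u +ᵥ w) +ᵥ (v +ᵥ x)
  +ᵥ-interchange [] [] [] [] = refl
  +ᵥ-interchange (a ∷ u) (b ∷ v) (c ∷ w) (d ∷ x) =
    cong₂ _∷_ (+-interchange a b c d) (+ᵥ-interchange u v w x)

  deg-one : ∀ {k} → deg (one {k}) ≡ 0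
  deg-one {zero} = refl
  deg-one {suc k} = deg-one {k}

  deg-+ᵥ : ∀ {k} (u v : Mon k) → deg (u +ᵥ v) ≡ deg u + deg v
  deg-+ᵥ [] [] = refl
  deg-+ᵥ (a ∷ u) (b ∷ v) =
    trans (cong ((a + b) +_) (deg-+ᵥ u v)) (+-interchange a b (deg u) (deg v))

  single : ∀ {k} → Fin k → ℕ → Mon k
  single zero c = c ∷ one
  single (suc i) c = 0 ∷ single i c

  lookup-single-≡ : ∀ {k} (i : Fin k) c → lookup (single i c) i ≡ c
  lookup-single-≡ zero c = refl
  lookup-single-≡ (suc i) c = lookup-single-≡ i c

  lookup-single-≢ : ∀ {k} (i j : Fin k) c → ¬ j ≡ i → lookup (single i c) j ≡ 0
  lookup-single-≢ zero zero c j≢i = ⊥-elim (j≢i refl)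
  lookup-single-≢ zero (suc j) c j≢i = lookup-replicate j 0
  lookup-single-≢ (suc i) zero c j≢i = refl
  lookup-single-≢ (suc i) (suc j) c j≢i = lookup-single-≢ i j c (j≢i ∘ cong suc)

  deg-single : ∀ {k} (i : Fin k) c → deg (single i c) ≡ c
  deg-single {suc k} zero c = trans (cong (c +_) (deg-one {k})) (+-identityʳ c)
  deg-single (suc i) c = deg-single i c

  single-0 : ∀ {k} (i : Fin k) → single i 0 ≡ one
  single-0 zero = refl
  single-0 (suc i) = cong (0 ∷_) (single-0 i)

  lookup-+single : ∀ {k} (t : Mon k) i c → lookup (t +ᵥ single i c) i ≡ lookup t i + c
  lookup-+single t i c = trans (lookup-zipWith _+_ i t (single i c)) (cong (lookup t i +_) (lookup-single-≡ i c))

  deg-+single : ∀ {k} (t : Mon k) i c → deg (t +ᵥ single i c) ≡ deg t + c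
  deg-+single t i c = trans (deg-+ᵥ t (single i c)) (cong (deg t +_) (deg-single i c))

  ext : ∀ {k} {u v : Mon k} → (∀ r → lookup u r ≡ lookup v r) → u ≡ v
  ext {u = u} {v} u≗v = trans (sym (tabulate∘lookup u)) (trans (tabulate-cong u≗v) (tabulate∘lookup v))

  two-variables : ∀ {k} (w : Mon k) p q → ¬ p ≡ q → (∀ r → ¬ r ≡ p → ¬ r ≡ q → lookup w r ≡ 0) →
    w ≡ single p (lookup w p) +ᵥ single q (lookup w q)
  two-variables w p q p≢q outside =
    ext λ r → trans (at r) (sym (lookup-zipWith _+_ r (single p (lookup w p)) (single q (lookup w q))))
    where
    at : ∀ r → lookup w r ≡ lookup (single p (lookup w p)) r + lookup (single q (lookup w q)) r
    at r with r Fin.≟ p | r Fin.≟ q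
    ... | yes refl | _ = sym (trans (cong₂ _+_ (lookup-single-≡ p _) (lookup-single-≢ q p _ p≢q)) (+-identityʳ _))
    ... | no r≢p | yes refl = sym (trans (cong (_+ _) (lookup-single-≢ p q _ r≢p)) (lookup-single-≡ q _))
    ... | no r≢p | no r≢q =
      trans (outside r r≢p r≢q) (sym (cong₂ _+_ (lookup-single-≢ p r _ r≢p) (lookup-single-≢ q r _ r≢q)))

  degS-tabulate : ∀ {m k d} (f : Fin (suc k) → Binom m) → (∀ i → degB (f i) ≡ d) → degS (tabulate f) ≡ d
  degS-tabulate {k = zero} f deg≡ = trans (⊔-identityʳ _) (deg≡ zero)
  degS-tabulate {k = suc k} {d} f deg≡ =
    trans (cong₂ _⊔_ (deg≡ zero) (degS-tabulate (f ∘ suc) (deg≡ ∘ suc))) (⊔-idem d)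

  one-∣ₘ : ∀ {k} (u : Mon k) → one ∣ₘ u
  one-∣ₘ u i rewrite lookup-replicate i 0 = z≤n

  single-∤ : ∀ {k} (i : Fin k) w → lookup w i ≡ 0 → ¬ single i 1 ∣ₘ w
  single-∤ i w wᵢ≡0 xᵢ∣w with subst (1 ≤_) wᵢ≡0 (subst (_≤ lookup w i) (lookup-single-≡ i 1) (xᵢ∣w i))
  ... | ()

  ∣ₘ-one : ∀ {k} (w : Mon k) → w ∣ₘ one → w ≡ one
  ∣ₘ-one [] w∣1 = refl
  ∣ₘ-one (a ∷ w) w∣1 = cong₂ _∷_ (n≤0⇒n≡0 (w∣1 zero)) (∣ₘ-one w (w∣1 ∘ suc))

  ∣ₘ-single : ∀ {k} (w : Mon k) i c → w ∣ₘ single i c → w ≡ single i (lookup w i) × lookup w i ≤ c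
  ∣ₘ-single (a ∷ w) zero c w∣ = cong (a ∷_) (∣ₘ-one w (w∣ ∘ suc)) , w∣ zero
  ∣ₘ-single (a ∷ w) (suc i) c w∣ with ∣ₘ-single w i c (w∣ ∘ suc)
  ... | w≡ , le = cong₂ _∷_ (n≤0⇒n≡0 (w∣ zero)) w≡ , le

module FibreGraph where
  open import Data.Product using (_,_)

  data Connected {m s} (S : Binom m → Set s) : Mon m → Mon m → Set s where
    ~-step  : ∀ {u v} → S (u , v) → ∀ t → Connected S (t +ᵥ u) (t +ᵥ v)
    ~-refl  : ∀ {u} → Connected S u u
    ~-sym   : ∀ {u v} → Connected S u v → Connected S v u
    ~-trans : ∀ {u w v} → Connected S u w → Connected S w v → Connected S u v

module ADegree where
  open import Data.Nat using (_+_; _*_)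
  open import Data.Nat.Properties using (*-distribʳ-+)
  open import Data.Vec using (Vec; []; _∷_; map)
  open import Data.Product using (_,_)
  open import Relation.Binary.PropositionalEquality using (refl; sym; trans; cong; cong₂)
  open Monomials
  open FibreGraph

  map-*-distrib : ∀ {n} x y (a : Vec ℕ n) → map ((x + y) *_) a ≡ map (x *_) a +ᵥ map (y *_) a
  map-*-distrib x y [] = refl
  map-*-distrib x y (z ∷ a) = cong₂ _∷_ (*-distribʳ-+ z x y) (map-*-distrib x y a)

  adeg-+ᵥ : ∀ {n m} (A : Config n m) u v → adeg A (u +ᵥ v) ≡ adeg A u +ᵥ adeg A v
  adeg-+ᵥ [] [] [] = sym (+ᵥ-identityˡ one)
  adeg-+ᵥ (a ∷ A) (x ∷ u) (y ∷ v) =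
    trans (cong₂ _+ᵥ_ (map-*-distrib x y a) (adeg-+ᵥ A u v)) (+ᵥ-interchange _ _ _ _)

  adeg-translate : ∀ {n m} (A : Config n m) {u v} → adeg A u ≡ adeg A v → ∀ t → adeg A (t +ᵥ u) ≡ adeg A (t +ᵥ v)
  adeg-translate A {u} {v} eq t =
    trans (adeg-+ᵥ A t u) (trans (cong (adeg A t +ᵥ_) eq) (sym (adeg-+ᵥ A t v)))

  Connected⇒adeg : ∀ {n m s} (A : Config n m) {S : Binom m → Set s} →
    (∀ {u v} → S (u , v) → adeg A u ≡ adeg A v) →
    ∀ {u v} → Connected S u v → adeg A u ≡ adeg A v
  Connected⇒adeg A S⊆ (~-step Suv t) = adeg-translate A (S⊆ Suv) t
  Connected⇒adeg A S⊆ ~-refl = refl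
  Connected⇒adeg A S⊆ (~-sym u~v) = sym (Connected⇒adeg A S⊆ u~v)
  Connected⇒adeg A S⊆ (~-trans u~w w~v) = trans (Connected⇒adeg A S⊆ u~w) (Connected⇒adeg A S⊆ w~v)

-- Double negation as a (non-dependent) applicative: the coefficient equality
-- of a field is not decidable, so facts about coefficients that are
-- obtained by contradiction live under ¬¬.
module DoubleNegation where
  open import Relation.Nullary using (¬_)

  ¬¬-zipWith : ∀ {a b d} {A : Set a} {B : Set b} {D : Set d} →
               (A → B → D) → ¬ ¬ A → ¬ ¬ B → ¬ ¬ D
  ¬¬-zipWith f ¬¬a ¬¬b ¬d = ¬¬a (λ a → ¬¬b (λ b → ¬d (f a b)))

-- Formal sums Σ a·x^w over a field, studied through their pairings with
-- weight functions ω : Mon m → K.  Coefficients are pairings with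
-- indicators, membership in an ideal generated by binomials is a
-- combination Σ gᵢ·bᵢ, and a weight that is "balanced" on the generating
-- binomials annihilates every such combination.
module FormalSums {c ℓ} (F : Field c ℓ) (m : ℕ) where
  import Data.Nat as ℕ
  import Data.Nat.Properties as ℕ
  open import Level using (_⊔_)
  open import Data.List using ([]; _∷_; _++_; length; foldr)
  import Data.List.Properties as List
  open import Data.List.Membership.Propositional using (_∈_)
  open import Data.List.Membership.Propositional.Properties using (∈-++⁻)
  open import Data.List.Relation.Unary.Any using (here; there)
  open import Data.Product using (_,_; map₁)
  open import Data.Sum using (_⊎_; inj₁; inj₂)
  open import Data.Vec.Properties using (≡-dec)
  open import Function using (_∘_)
  open import Relation.Nullary using (¬_; yes; no)
  open import Relation.Nullary.Negation using (¬¬-map; contradiction)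
  import Relation.Binary.PropositionalEquality as ≡
  open Field F hiding (zero)
  open Polynomials F m
  open Monomials
  open FibreGraph
  open DoubleNegation
  open import Algebra.Properties.Ring ring using (-1*x≈-x; -‿distribˡ-*; -‿distribʳ-*; -0#≈0#; -‿involutive)
  open import Algebra.Properties.AbelianGroup +-abelianGroup using (⁻¹-∙-comm; ⁻¹-anti-homo‿-)
  open import Algebra.Properties.CommutativeSemigroup +-commutativeSemigroup using (x∙yz≈y∙xz)
  open import Relation.Binary.Reasoning.Setoid setoid

  -- Two abelian-group identities: the contribution of one term a·x^t to
  -- the pairing of g·(x^u − x^v), and telescoping of differences.
  cons-difference : ∀ a X Y P Q →
    (a * 1#) * X + ((a * - 1#) * Y + (P - Q)) ≈ (a * X + P) - (a * Y + Q)
  cons-difference a X Y P Q = begin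
    (a * 1#) * X + ((a * - 1#) * Y + (P - Q)) ≈⟨ +-cong (*-congʳ (*-identityʳ a)) (+-congʳ negated) ⟩
    a * X + (- (a * Y) + (P - Q))              ≈⟨ +-congˡ (x∙yz≈y∙xz _ _ _) ⟩
    a * X + (P + (- (a * Y) + - Q))            ≈⟨ sym (+-assoc _ _ _) ⟩
    (a * X + P) + (- (a * Y) + - Q)            ≈⟨ +-congˡ (⁻¹-∙-comm _ _) ⟩
    (a * X + P) - (a * Y + Q)                  ∎
    where
    negated : (a * - 1#) * Y ≈ - (a * Y)
    negated = begin
      (a * - 1#) * Y ≈⟨ *-assoc _ _ _ ⟩
      a * (- 1# * Y) ≈⟨ *-congˡ (-1*x≈-x Y) ⟩
      a * - Y        ≈⟨ sym (-‿distribʳ-* a Y) ⟩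
      - (a * Y)      ∎

  difference-telescope : ∀ U W V → (U - W) + (W - V) ≈ U - V
  difference-telescope U W V = begin
    (U - W) + (W - V)   ≈⟨ +-assoc _ _ _ ⟩
    U + (- W + (W - V)) ≈⟨ +-congˡ (sym (+-assoc _ _ _)) ⟩
    U + ((- W + W) - V) ≈⟨ +-congˡ (+-congʳ (-‿inverseˡ W)) ⟩
    U + (0# - V)        ≈⟨ +-congˡ (+-identityˡ _) ⟩
    U - V               ∎

  pairing : (Mon m → Carrier) → Poly → Carrier
  pairing ω [] = 0#
  pairing ω ((a , w) ∷ p) = a * ω w + pairing ω p

  pairing-++ : ∀ ω p q → pairing ω (p ++ q) ≈ pairing ω p + pairing ω q
  pairing-++ ω [] q = sym (+-identityˡ _)
  pairing-++ ω ((a , w) ∷ p) q = trans (+-congˡ (pairing-++ ω p q)) (sym (+-assoc _ _ _))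

  pairing-congˡ : ∀ {ω ω′} → (∀ w → ω w ≈ ω′ w) → ∀ p → pairing ω p ≈ pairing ω′ p
  pairing-congˡ ω≈ [] = refl
  pairing-congˡ ω≈ ((a , w) ∷ p) = +-cong (*-congˡ (ω≈ w)) (pairing-congˡ ω≈ p)

  -- the weight t ↦ ω(t + u): multiplying by x^u shifts the weight
  translate : (Mon m → Carrier) → Mon m → Mon m → Carrier
  translate ω u t = ω (t +ᵥ u)

  pairing-binom : ∀ ω u v → pairing ω (binom (u , v)) ≈ ω u - ω v
  pairing-binom ω u v = +-cong (*-identityˡ _) (trans (+-identityʳ _) (-1*x≈-x _))

  pairing-*binom : ∀ ω g u v →
    pairing ω (g *ₚ binom (u , v)) ≈ pairing (translate ω u) g - pairing (translate ω v) g
  pairing-*binom ω [] u v = sym (-‿inverseʳ 0#)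
  pairing-*binom ω ((a , t) ∷ g) u v =
    trans (+-congˡ (+-congˡ (pairing-*binom ω g u v))) (cons-difference a _ _ _ _)

  pairing-*monomial : ∀ ω g w → pairing ω (g *ₚ ((1# , w) ∷ [])) ≈ pairing (translate ω w) g
  pairing-*monomial ω [] w = refl
  pairing-*monomial ω ((a , t) ∷ g) w = +-cong (*-congʳ (*-identityʳ a)) (pairing-*monomial ω g w)

  negate : Poly → Poly
  negate = Data.List.map (map₁ (λ a → - a))

  pairing-negate : ∀ ω g → pairing ω (negate g) ≈ - pairing ω g
  pairing-negate ω [] = sym -0#≈0#
  pairing-negate ω ((a , w) ∷ g) = begin
    - a * ω w + pairing ω (negate g) ≈⟨ +-cong (sym (-‿distribˡ-* a (ω w))) (pairing-negate ω g) ⟩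
    - (a * ω w) + - pairing ω g      ≈⟨ ⁻¹-∙-comm _ _ ⟩
    - (a * ω w + pairing ω g)        ∎

  indicator : Mon m → Mon m → Carrier
  indicator u w with ≡-dec ℕ._≟_ w u
  ... | yes _ = 1#
  ... | no _ = 0#

  indicator-≢ : ∀ {u w} → ¬ w ≡ u → indicator u w ≈ 0#
  indicator-≢ {u} {w} w≢u with ≡-dec ℕ._≟_ w u
  ... | yes w≡u = contradiction w≡u w≢u
  ... | no _ = refl

  coeff≈pairing : ∀ p u → coeff p u ≈ pairing (indicator u) p
  coeff≈pairing [] u = refl
  coeff≈pairing ((a , w) ∷ p) u with ≡-dec ℕ._≟_ w u
  ... | yes _ = +-cong (sym (*-identityʳ a)) (coeff≈pairing p u)
  ... | no _ = trans (coeff≈pairing p u) (sym (trans (+-congʳ (zeroʳ a)) (+-identityˡ _)))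

  coeff-cons-≢ : ∀ {v u} a p → ¬ v ≡ u → coeff ((a , v) ∷ p) u ≡ coeff p u
  coeff-cons-≢ {v} {u} a p v≢u with ≡-dec ℕ._≟_ v u
  ... | yes v≡u = contradiction v≡u v≢u
  ... | no _ = ≡.refl

  coeff-cons-cong : ∀ {p q u} a v → coeff p u ≈ coeff q u → coeff ((a , v) ∷ p) u ≈ coeff ((a , v) ∷ q) u
  coeff-cons-cong {u = u} a v p≈q with ≡-dec ℕ._≟_ v u
  ... | yes _ = +-congˡ p≈q
  ... | no _ = p≈q

  ≈ₚ-from-pairing : ∀ p q → (∀ ω → pairing ω p ≈ pairing ω q) → p ≈ₚ q
  ≈ₚ-from-pairing p q p~q u =
    trans (coeff≈pairing p u) (trans (p~q (indicator u)) (sym (coeff≈pairing q u)))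

  coeff-++ : ∀ p q u → coeff (p ++ q) u ≈ coeff p u + coeff q u
  coeff-++ p q u = trans (coeff≈pairing (p ++ q) u)
    (trans (pairing-++ (indicator u) p q) (sym (+-cong (coeff≈pairing p u) (coeff≈pairing q u))))

  ++-congₚ : ∀ {p p′ q q′} → p ≈ₚ p′ → q ≈ₚ q′ → (p ++ q) ≈ₚ (p′ ++ q′)
  ++-congₚ {p} {p′} {q} {q′} p≈ q≈ u =
    trans (coeff-++ p q u) (trans (+-cong (p≈ u) (q≈ u)) (sym (coeff-++ p′ q′ u)))

  coeff-binom-left : ∀ u v → ¬ u ≡ v → coeff (binom (u , v)) u ≈ 1#
  coeff-binom-left u v u≢v with ≡-dec ℕ._≟_ u u
  ... | no u≢u = contradiction ≡.refl u≢u
  ... | yes _ = trans (+-congˡ (reflexive (coeff-cons-≢ (- 1#) [] (u≢v ∘ ≡.sym)))) (+-identityʳ 1#)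

  coeff-term : ∀ a u → coeff ((a , u) ∷ []) u ≈ a
  coeff-term a u with ≡-dec ℕ._≟_ u u
  ... | yes _ = +-identityʳ a
  ... | no u≢u = contradiction ≡.refl u≢u

  coeff-binom-right : ∀ u v → ¬ u ≡ v → coeff (binom (u , v)) v ≈ - 1#
  coeff-binom-right u v u≢v = trans (reflexive (coeff-cons-≢ 1# ((- 1# , v) ∷ []) u≢v)) (coeff-term (- 1#) v)

  binom-support : ∀ u v x → ¬ coeff (binom (u , v)) x ≈ 0# → x ≡ u ⊎ x ≡ v
  binom-support u v x nonzero with ≡-dec ℕ._≟_ x u | ≡-dec ℕ._≟_ x v
  ... | yes x≡u | _ = inj₁ x≡u
  ... | no _ | yes x≡v = inj₂ x≡v
  ... | no x≢u | no x≢v = contradiction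
    (reflexive (≡.trans (coeff-cons-≢ 1# _ (x≢u ∘ ≡.sym)) (coeff-cons-≢ (- 1#) [] (x≢v ∘ ≡.sym)))) nonzero

  -1≉0 : ¬ - 1# ≈ 0#
  -1≉0 -1≈0 = 1≉0 (trans (sym (-‿involutive 1#)) (trans (-‿cong -1≈0) -0#≈0#))

  *binom-refl : ∀ g u x → coeff (g *ₚ binom (u , u)) x ≈ 0#
  *binom-refl g u x =
    trans (coeff≈pairing (g *ₚ binom (u , u)) x) (trans (pairing-*binom (indicator x) g u u) (-‿inverseʳ _))

  *binom-split : ∀ g u w v →
    (g *ₚ binom (u , v)) ≈ₚ ((g *ₚ binom (u , w)) ++ (g *ₚ binom (w , v)))
  *binom-split g u w v =
    ≈ₚ-from-pairing (g *ₚ binom (u , v)) ((g *ₚ binom (u , w)) ++ (g *ₚ binom (w , v))) λ ω → begin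
      pairing ω (g *ₚ binom (u , v))
        ≈⟨ pairing-*binom ω g u v ⟩
      pairing (translate ω u) g - pairing (translate ω v) g
        ≈⟨ sym (difference-telescope _ _ _) ⟩
      (pairing (translate ω u) g - pairing (translate ω w) g) + (pairing (translate ω w) g - pairing (translate ω v) g)
        ≈⟨ sym (+-cong (pairing-*binom ω g u w) (pairing-*binom ω g w v)) ⟩
      pairing ω (g *ₚ binom (u , w)) + pairing ω (g *ₚ binom (w , v))
        ≈⟨ sym (pairing-++ ω (g *ₚ binom (u , w)) (g *ₚ binom (w , v))) ⟩
      pairing ω ((g *ₚ binom (u , w)) ++ (g *ₚ binom (w , v)))
        ∎

  *binom-swap : ∀ g u v → (negate g *ₚ binom (u , v)) ≈ₚ (g *ₚ binom (v , u))
  *binom-swap g u v = ≈ₚ-from-pairing (negate g *ₚ binom (u , v)) (g *ₚ binom (v , u)) λ ω → begin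
    pairing ω (negate g *ₚ binom (u , v))
      ≈⟨ pairing-*binom ω (negate g) u v ⟩
    pairing (translate ω u) (negate g) - pairing (translate ω v) (negate g)
      ≈⟨ +-cong (pairing-negate _ g) (-‿cong (pairing-negate _ g)) ⟩
    - pairing (translate ω u) g - - pairing (translate ω v) g
      ≈⟨ ⁻¹-∙-comm _ _ ⟩
    - (pairing (translate ω u) g - pairing (translate ω v) g)
      ≈⟨ ⁻¹-anti-homo‿- _ _ ⟩
    pairing (translate ω v) g - pairing (translate ω u) g
      ≈⟨ sym (pairing-*binom ω g v u) ⟩
    pairing ω (g *ₚ binom (v , u))
      ∎

  *binom-translate : ∀ g w a b →
    ((g *ₚ ((1# , w) ∷ [])) *ₚ binom (a , b)) ≈ₚ (g *ₚ binom (w +ᵥ a , w +ᵥ b))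
  *binom-translate g w a b =
    ≈ₚ-from-pairing ((g *ₚ ((1# , w) ∷ [])) *ₚ binom (a , b)) (g *ₚ binom (w +ᵥ a , w +ᵥ b)) λ ω → begin
    pairing ω ((g *ₚ ((1# , w) ∷ [])) *ₚ binom (a , b))   ≈⟨ pairing-*binom ω (g *ₚ ((1# , w) ∷ [])) a b ⟩
    pairing (translate ω a) (g *ₚ ((1# , w) ∷ []))
      - pairing (translate ω b) (g *ₚ ((1# , w) ∷ []))    ≈⟨ +-cong (shift {ω} a) (-‿cong (shift {ω} b)) ⟩
    pairing (translate ω (w +ᵥ a)) g
      - pairing (translate ω (w +ᵥ b)) g                  ≈⟨ sym (pairing-*binom ω g _ _) ⟩
    pairing ω (g *ₚ binom (w +ᵥ a , w +ᵥ b))              ∎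
    where
    shift : ∀ {ω} a → pairing (translate ω a) (g *ₚ ((1# , w) ∷ [])) ≈ pairing (translate ω (w +ᵥ a)) g
    shift {ω} a = trans (pairing-*monomial _ g w)
      (pairing-congˡ (λ t → reflexive (≡.cong ω (+ᵥ-assoc t w a))) g)

  binom≈unit*binom : ∀ b → binom b ≈ₚ (((1# , one) ∷ []) *ₚ binom b)
  binom≈unit*binom (u , v) =
    ≈ₚ-from-pairing (binom (u , v)) (((1# , one) ∷ []) *ₚ binom (u , v)) λ ω → begin
    pairing ω (binom (u , v))                                       ≈⟨ pairing-binom ω u v ⟩
    ω u - ω v                                                       ≈⟨ sym (+-cong (unit {ω} u) (-‿cong (unit {ω} v))) ⟩
    pairing (translate ω u) ((1# , one) ∷ [])
      - pairing (translate ω v) ((1# , one) ∷ [])                   ≈⟨ sym (pairing-*binom ω ((1# , one) ∷ []) u v) ⟩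
    pairing ω (((1# , one) ∷ []) *ₚ binom (u , v))                  ∎
    where
    unit : ∀ {ω} u → pairing (translate ω u) ((1# , one) ∷ []) ≈ ω u
    unit {ω} u = trans (+-identityʳ _) (trans (*-identityˡ _) (reflexive (≡.cong ω (+ᵥ-identityˡ u))))

  -- Ideals generated by binomials.  `Span S f` says f = Σ gᵢ·bᵢ with S bᵢ;
  -- it is `InIdeal` of the definitions with its anonymous fold named, so
  -- that membership can be built and taken apart by structural recursion.

  combination : List (Poly × Binom m) → Poly
  combination [] = []
  combination ((g , b) ∷ gs) = (g *ₚ binom b) ++ combination gs

  record Span {s} (S : Binom m → Set s) (f : Poly) : Set (c ⊔ ℓ ⊔ s) where
    constructor span
    field
      terms      : List (Poly × Binom m)
      generators : ∀ {g b} → (g , b) ∈ terms → S b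
      expansion  : f ≈ₚ combination terms

  fold≡combination : ∀ {Λ : Poly × Binom m → Poly → Poly} →
    (∀ g b h → Λ (g , b) h ≡ (g *ₚ binom b) ++ h) → ∀ gs → foldr Λ [] gs ≡ combination gs
  fold≡combination Λ-step [] = ≡.refl
  fold≡combination Λ-step ((g , b) ∷ gs) =
    ≡.trans (Λ-step g b _) (≡.cong ((g *ₚ binom b) ++_) (fold≡combination Λ-step gs))

  module _ {s} {S : Binom m → Set s} where

    toSpan : ∀ f → InIdeal S f → Span S f
    toSpan f (gs , gens , f≈) = span gs gens λ u →
      trans (f≈ u) (reflexive (≡.cong (λ p → coeff p u) (fold≡combination (λ _ _ _ → ≡.refl) gs)))

    fromSpan : ∀ {f} → Span S f → InIdeal S f
    fromSpan (span gs gens f≈) = gs , gens , λ u →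
      trans (f≈ u) (reflexive (≡.cong (λ p → coeff p u) (≡.sym (fold≡combination (λ _ _ _ → ≡.refl) gs))))

    Span-resp : ∀ {f f′} → f ≈ₚ f′ → Span S f′ → Span S f
    Span-resp f≈f′ (span gs gens f′≈) = span gs gens λ u → trans (f≈f′ u) (f′≈ u)

    Span-zero : ∀ {f} → (∀ u → coeff f u ≈ 0#) → Span S f
    Span-zero f≈0 = span [] (λ ()) f≈0

    Span-generator : ∀ {b} → S b → ∀ g → Span S (g *ₚ binom b)
    Span-generator {b} Sb g = span ((g , b) ∷ []) gens λ u →
      reflexive (≡.cong (λ p → coeff p u) (≡.sym (List.++-identityʳ (g *ₚ binom b))))
      where
      gens : ∀ {g′ b′} → (g′ , b′) ∈ ((g , b) ∷ []) → S b′
      gens (here ≡.refl) = Sb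

    Span-binom : ∀ {b} → S b → Span S (binom b)
    Span-binom {b} Sb = Span-resp (binom≈unit*binom b) (Span-generator Sb ((1# , one) ∷ []))

    combination-++ : ∀ gs hs → combination (gs ++ hs) ≡ combination gs ++ combination hs
    combination-++ [] hs = ≡.refl
    combination-++ ((g , b) ∷ gs) hs =
      ≡.trans (≡.cong ((g *ₚ binom b) ++_) (combination-++ gs hs))
              (≡.sym (List.++-assoc (g *ₚ binom b) (combination gs) (combination hs)))

    Span-++ : ∀ {p q} → Span S p → Span S q → Span S (p ++ q)
    Span-++ {p} {q} (span gs gens p≈) (span hs hens q≈) = span (gs ++ hs) gens++hens λ u →
      trans (++-congₚ {p} {combination gs} {q} {combination hs} p≈ q≈ u)
            (reflexive (≡.cong (λ r → coeff r u) (≡.sym (combination-++ gs hs))))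
      where
      gens++hens : ∀ {g b} → (g , b) ∈ (gs ++ hs) → S b
      gens++hens g,b∈ with ∈-++⁻ gs g,b∈
      ... | inj₁ ∈gs = gens ∈gs
      ... | inj₂ ∈hs = hens ∈hs

  Span-transfer : ∀ {s t} {S : Binom m → Set s} {T : Binom m → Set t} →
    (∀ {b} → S b → ∀ g → Span T (g *ₚ binom b)) → ∀ {f} → Span S f → Span T f
  Span-transfer {S = S} {T} S⊆T (span gs gens f≈) = Span-resp f≈ (go gs gens)
    where
    go : ∀ gs → (∀ {g b} → (g , b) ∈ gs → S b) → Span T (combination gs)
    go [] gens = Span-zero (λ u → refl)
    go ((g , b) ∷ gs) gens = Span-++ (S⊆T (gens (here ≡.refl)) g) (go gs (gens ∘ there))

  Balanced : ∀ {s} → (Mon m → Carrier) → (Binom m → Set s) → Set (ℓ ⊔ s)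
  Balanced ω S = ∀ {u v} → S (u , v) → ∀ t → ω (t +ᵥ u) ≈ ω (t +ᵥ v)

  pairing-combination : ∀ {s} {S : Binom m → Set s} {ω} → Balanced ω S →
    ∀ gs → (∀ {g b} → (g , b) ∈ gs → S b) → pairing ω (combination gs) ≈ 0#
  pairing-combination bal [] gens = refl
  pairing-combination {ω = ω} bal ((g , (u , v)) ∷ gs) gens = begin
    pairing ω ((g *ₚ binom (u , v)) ++ combination gs)
      ≈⟨ pairing-++ ω (g *ₚ binom (u , v)) (combination gs) ⟩
    pairing ω (g *ₚ binom (u , v)) + pairing ω (combination gs)
      ≈⟨ +-cong (pairing-*binom ω g u v) (pairing-combination bal gs (gens ∘ there)) ⟩
    (pairing (translate ω u) g - pairing (translate ω v) g) + 0#
      ≈⟨ +-identityʳ _ ⟩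
    pairing (translate ω u) g - pairing (translate ω v) g
      ≈⟨ +-congʳ (pairing-congˡ (bal (gens (here ≡.refl))) g) ⟩
    pairing (translate ω v) g - pairing (translate ω v) g
      ≈⟨ -‿inverseʳ _ ⟩
    0# ∎

  coeff-Span : ∀ {s} {S : Binom m → Set s} {f x} →
    Balanced (indicator x) S → Span S f → coeff f x ≈ 0#
  coeff-Span {x = x} bal (span gs gens f≈) =
    trans (f≈ x) (trans (coeff≈pairing (combination gs) x) (pairing-combination bal gs gens))

  without : Mon m → Poly → Poly
  without w [] = []
  without w ((a , v) ∷ p) with ≡-dec ℕ._≟_ v w
  ... | yes _ = without w p
  ... | no _ = (a , v) ∷ without w p

  length-without : ∀ w p → length (without w p) ℕ.≤ length p
  length-without w [] = ℕ.z≤n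
  length-without w ((a , v) ∷ p) with ≡-dec ℕ._≟_ v w
  ... | yes _ = ℕ.m≤n⇒m≤1+n (length-without w p)
  ... | no _ = ℕ.s≤s (length-without w p)

  length-without-head : ∀ a w p → length (without w ((a , w) ∷ p)) ℕ.≤ length p
  length-without-head a w p with ≡-dec ℕ._≟_ w w
  ... | yes _ = length-without w p
  ... | no w≢w = contradiction ≡.refl w≢w

  coeff-without-≡ : ∀ w p → coeff (without w p) w ≈ 0#
  coeff-without-≡ w [] = refl
  coeff-without-≡ w ((a , v) ∷ p) with ≡-dec ℕ._≟_ v w
  ... | yes _ = coeff-without-≡ w p
  ... | no v≢w = trans (reflexive (coeff-cons-≢ a (without w p) v≢w)) (coeff-without-≡ w p)

  coeff-without-≢ : ∀ w p x → ¬ x ≡ w → coeff (without w p) x ≈ coeff p x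
  coeff-without-≢ w [] x x≢w = refl
  coeff-without-≢ w ((a , v) ∷ p) x x≢w with ≡-dec ℕ._≟_ v w
  ... | yes ≡.refl = trans (coeff-without-≢ v p x x≢w) (reflexive (≡.sym (coeff-cons-≢ a p (x≢w ∘ ≡.sym))))
  ... | no _ = coeff-cons-cong a v (coeff-without-≢ w p x x≢w)

  pairing-without : ∀ ω w p → pairing ω p ≈ coeff p w * ω w + pairing ω (without w p)
  pairing-without ω w [] = sym (trans (+-identityʳ _) (zeroˡ _))
  pairing-without ω w ((a , v) ∷ p) with ≡-dec ℕ._≟_ v w
  ... | yes ≡.refl = begin
    a * ω v + pairing ω p                                      ≈⟨ +-congˡ (pairing-without ω v p) ⟩
    a * ω v + (coeff p v * ω v + pairing ω (without v p))      ≈⟨ sym (+-assoc _ _ _) ⟩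
    (a * ω v + coeff p v * ω v) + pairing ω (without v p)      ≈⟨ +-congʳ (sym (distribʳ _ _ _)) ⟩
    (a + coeff p v) * ω v + pairing ω (without v p)            ∎
  ... | no _ = trans (+-congˡ (pairing-without ω w p)) (x∙yz≈y∙xz _ _ _)

  Agree : (Mon m → Carrier) → Poly → Poly → Set ℓ
  Agree ω p q = ∀ w → ¬ ¬ (coeff p w * ω w ≈ coeff q w * ω w)

  Agree-without : ∀ {ω} p q w → Agree ω p q → Agree ω (without w p) (without w q)
  Agree-without p q w agree x with ≡-dec ℕ._≟_ x w
  ... | yes ≡.refl = contradiction (*-congʳ (trans (coeff-without-≡ x p) (sym (coeff-without-≡ x q))))
  ... | no x≢w = ¬¬-map
    (λ eq → trans (*-congʳ (coeff-without-≢ w p x x≢w)) (trans eq (sym (*-congʳ (coeff-without-≢ w q x x≢w)))))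
    (agree x)

  pairing-cong-¬¬ : ∀ ω p q → Agree ω p q → ¬ ¬ (pairing ω p ≈ pairing ω q)
  pairing-cong-¬¬ ω p q = go (length p ℕ.+ length q) p q ℕ.≤-refl
    where
    peel : ∀ w p q → Agree ω p q → ¬ ¬ (pairing ω (without w p) ≈ pairing ω (without w q)) →
           ¬ ¬ (pairing ω p ≈ pairing ω q)
    peel w p q agree = ¬¬-zipWith
      (λ head rest → trans (pairing-without ω w p) (trans (+-cong head rest) (sym (pairing-without ω w q))))
      (agree w)

    go : ∀ n p q → length p ℕ.+ length q ℕ.≤ n → Agree ω p q → ¬ ¬ (pairing ω p ≈ pairing ω q)
    go n [] [] _ _ = contradiction refl
    go ℕ.zero (_ ∷ _) q () agree
    go ℕ.zero [] (_ ∷ _) () agree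
    go (ℕ.suc n) ((a , w) ∷ p) q (ℕ.s≤s len) agree =
      peel w ((a , w) ∷ p) q agree
        (go n (without w ((a , w) ∷ p)) (without w q) shorter (Agree-without ((a , w) ∷ p) q w agree))
      where
      shorter : length (without w ((a , w) ∷ p)) ℕ.+ length (without w q) ℕ.≤ n
      shorter = ℕ.≤-trans (ℕ.+-mono-≤ (length-without-head a w p) (length-without w q)) len
    go (ℕ.suc n) [] ((b , w) ∷ q) (ℕ.s≤s len) agree =
      peel w [] ((b , w) ∷ q) agree
        (go n [] (without w ((b , w) ∷ q)) (ℕ.≤-trans (length-without-head b w q) len)
            (Agree-without [] ((b , w) ∷ q) w agree))

  Span-balanced-¬¬ : ∀ {s} {S : Binom m → Set s} {ω f} → Balanced ω S → Span S f → ¬ ¬ (pairing ω f ≈ 0#)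
  Span-balanced-¬¬ {ω = ω} {f} bal (span gs gens f≈) = ¬¬-map
    (λ eq → trans eq (pairing-combination bal gs gens))
    (pairing-cong-¬¬ ω f (combination gs) (λ w → contradiction (*-congʳ (f≈ w))))

  -- Connected monomials differ by an element of the ideal generated by S
  -- (the easy half of the fundamental theorem of Markov bases).
  Connected⇒Span : ∀ {s} {S : Binom m → Set s} {u v} → Connected S u v → ∀ g → Span S (g *ₚ binom (u , v))
  Connected⇒Span (~-step {u} {v} Suv t) g =
    Span-resp (λ x → sym (*binom-translate g t u v x)) (Span-generator Suv (g *ₚ ((1# , t) ∷ [])))
  Connected⇒Span {u = u} ~-refl g = Span-zero (*binom-refl g u)
  Connected⇒Span {u = v} {u} (~-sym u~v) g =
    Span-resp (λ x → sym (*binom-swap g u v x)) (Connected⇒Span u~v (negate g))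
  Connected⇒Span {u = u} {v} (~-trans {w = w} u~w w~v) g =
    Span-resp (*binom-split g u w v) (Span-++ (Connected⇒Span u~w g) (Connected⇒Span w~v g))

module ToricIdeals {c ℓ} (F : Field c ℓ) {n m : ℕ} (A : Config n m) where
  import Data.Nat as ℕ
  open import Data.List.Membership.Propositional using (_∈_)
  open import Data.Product using (_,_; proj₁; proj₂)
  import Data.Product.Properties as Product
  open import Data.Vec using (Vec)
  open import Data.Vec.Properties using (≡-dec)
  open import Data.Empty using (⊥-elim)
  open import Relation.Nullary using (¬_; yes; no)
  open import Function using (_∘_)
  open import Relation.Nullary.Negation using (contradiction)
  import Relation.Binary.PropositionalEquality as ≡
  open Field F hiding (zero)
  open import Algebra.Properties.Ring ring using (-0#≈0#)
  open import Relation.Binary.Reasoning.Setoid setoid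
  open Polynomials F m
  open Toric A
  open FormalSums F m
  open Monomials
  open ADegree
  open FibreGraph

  fibre : Vec ℕ n → Mon m → Carrier
  fibre d w with ≡-dec ℕ._≟_ (adeg A w) d
  ... | yes _ = 1#
  ... | no _ = 0#

  fibre-≡ : ∀ {d w} → adeg A w ≡ d → fibre d w ≈ 1#
  fibre-≡ {d} {w} w∈d with ≡-dec ℕ._≟_ (adeg A w) d
  ... | yes _ = refl
  ... | no w∉d = contradiction w∈d w∉d

  fibre-≢ : ∀ {d w} → ¬ adeg A w ≡ d → fibre d w ≈ 0#
  fibre-≢ {d} {w} w∉d with ≡-dec ℕ._≟_ (adeg A w) d
  ... | yes w∈d = contradiction w∈d w∉d
  ... | no _ = refl

  fibre-resp : ∀ {d u v} → adeg A u ≡ adeg A v → fibre d u ≈ fibre d v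
  fibre-resp {d} {u} {v} eq with ≡-dec ℕ._≟_ (adeg A v) d
  ... | yes v∈d = fibre-≡ (≡.trans eq v∈d)
  ... | no v∉d = fibre-≢ (λ u∈d → v∉d (≡.trans (≡.sym eq) u∈d))

  fibre-balanced : ∀ d → Balanced (fibre d) SameADeg
  fibre-balanced d eq t = fibre-resp (adeg-translate A eq t)

  IA-fibre-¬¬ : ∀ d f → InIA f → ¬ ¬ (pairing (fibre d) f ≈ 0#)
  IA-fibre-¬¬ d f f∈IA = Span-balanced-¬¬ {ω = fibre d} {f} (fibre-balanced d) (toSpan f f∈IA)

  binom∈IA⇒SameADeg : ∀ {u v} → BinInIA (u , v) → SameADeg (u , v)
  binom∈IA⇒SameADeg {u} {v} b∈IA with ≡-dec ℕ._≟_ (adeg A u) (adeg A v)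
  ... | yes eq = eq
  ... | no u≉v = ⊥-elim (IA-fibre-¬¬ (adeg A u) (binom (u , v)) b∈IA (λ pairing≈0 → 1≉0 (begin
    1#                                ≈⟨ sym (trans (+-congˡ -0#≈0#) (+-identityʳ 1#)) ⟩
    1# - 0#                           ≈⟨ sym (+-cong (fibre-≡ ≡.refl) (-‿cong (fibre-≢ (u≉v ∘ ≡.sym)))) ⟩
    fibre (adeg A u) u - fibre (adeg A u) v ≈⟨ sym (pairing-binom _ u v) ⟩
    pairing (fibre (adeg A u)) (binom (u , v)) ≈⟨ pairing≈0 ⟩
    0#                                ∎)))

  SameADeg⇒binom∈IA : ∀ {b} → SameADeg b → BinInIA b
  SameADeg⇒binom∈IA eq = fromSpan (Span-binom eq)

  generates-if-connected : ∀ M → (∀ {b} → b ∈ M → SameADeg b) →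
    (∀ u v → SameADeg (u , v) → Connected (_∈ M) u v) → Generates M
  generates-if-connected M M⊆IA connected =
    (λ b∈M → SameADeg⇒binom∈IA (M⊆IA b∈M)) ,
    (λ f f∈IA → fromSpan (Span-transfer (λ {b} eq g → Connected⇒Span (connected _ _ eq) g) (toSpan f f∈IA)))

  Avoids : Binom m → Mon m → Set
  Avoids (u , v) x = ∀ t → ¬ t +ᵥ u ≡ x × ¬ t +ᵥ v ≡ x

  Isolated : List (Binom m) → Set ℓ
  Isolated M = ∀ {b} → b ∈ M →
    ∃[ x ] (¬ coeff (binom b) x ≈ 0# × (∀ {b′} → b′ ∈ M → ¬ b′ ≡ b → Avoids b′ x))

  -- An isolated generating set is minimal: dropping b loses the monomial
  -- x of b from every combination.
  markov-if-isolated : ∀ M → Generates M → Isolated M → IsMarkovBasis M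
  markov-if-isolated M gen isolated = gen , minimal
    where
    open import Data.List.Membership.DecPropositional (Product.≡-dec (≡-dec ℕ._≟_) (≡-dec ℕ._≟_))
      using (_∈?_)
    minimal : ∀ M′ → (∀ {b} → b ∈ M′ → b ∈ M) → Generates M′ → ∀ {b} → b ∈ M → b ∈ M′
    minimal M′ M′⊆M gen′ {b} b∈M with b ∈? M′ | isolated b∈M
    ... | yes b∈M′ | _ = b∈M′
    ... | no b∉M′ | x , coeff-x≉0 , others-avoid = ⊥-elim (coeff-x≉0 (coeff-Span balanced (toSpan (binom b) b∈span)))
      where
      b∈span : InIdeal (_∈ M′) (binom b)
      b∈span = proj₂ gen′ (binom b) (proj₁ gen b∈M)

      balanced : Balanced (indicator x) (_∈ M′)
      balanced b′∈M′ t with others-avoid (M′⊆M b′∈M′) (λ { ≡.refl → b∉M′ b′∈M′ }) t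
      ... | u-avoids , v-avoids = trans (indicator-≢ u-avoids) (sym (indicator-≢ v-avoids))

module PowersOfTwo where
  open import Data.Nat using (zero; suc; _+_; _*_; _⊔_; _^_; _≤_; _<_; _≤?_; _∸_; z≤n; s≤s; s≤s⁻¹; NonZero)
  open import Data.Nat.Properties
  open import Data.Nat.DivMod using (_/_; +-distrib-/-∣ˡ; m*n/n≡m; m<n⇒m/n≡0)
  open import Data.Nat.Divisibility using (n∣m*n)
  open import Data.Fin using (zero; suc; inject₁; fromℕ)
  open import Data.Vec using (Vec; []; _∷_; head; tail)
  open import Data.Vec.Relation.Unary.All using (All; []; _∷_)
  open import Data.Product using (_,_; proj₁; proj₂; ∃₂)
  open import Data.List using (tabulate)
  open import Data.List.Membership.Propositional using (_∈_)
  open import Data.List.Membership.Propositional.Properties using (∈-tabulate⁺; ∈-tabulate⁻)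
  import Data.Fin.Properties as Fin
  open import Data.Sum using (_⊎_; inj₁; inj₂)
  open import Data.Empty using (⊥-elim)
  open import Relation.Nullary using (yes; no)
  open import Relation.Binary.PropositionalEquality using (refl; sym; trans; cong; cong₂; module ≡-Reasoning)
  open Monomials
  open FibreGraph
  open ADegree

  configuration : ∀ K → Config 1 (suc K)
  configuration zero = (1 ∷ []) ∷ []
  configuration (suc K) = (2 ^ suc K ∷ []) ∷ configuration K

  -- the weight 2^(K−i) of the variable xᵢ
  weight : ∀ {K} → Fin (suc K) → ℕ
  weight {zero} zero = 1
  weight {suc K} zero = 2 ^ suc K
  weight {suc K} (suc i) = weight {K} i

  value : ∀ K → Mon (suc K) → ℕ
  value zero (a ∷ []) = a * 1 + 0
  value (suc K) (a ∷ u) = a * 2 ^ suc K + value K u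

  adeg≡value : ∀ K u → adeg (configuration K) u ≡ value K u ∷ []
  adeg≡value zero (a ∷ []) = refl
  adeg≡value (suc K) (a ∷ u) rewrite adeg≡value K u = refl

  SameADeg⇒value : ∀ K {u v} → adeg (configuration K) u ≡ adeg (configuration K) v → value K u ≡ value K v
  SameADeg⇒value K {u} {v} eq = cong head (trans (sym (adeg≡value K u)) (trans eq (adeg≡value K v)))

  value⇒SameADeg : ∀ K {u v} → value K u ≡ value K v → adeg (configuration K) u ≡ adeg (configuration K) v
  value⇒SameADeg K {u} {v} eq = trans (adeg≡value K u) (trans (cong (_∷ []) eq) (sym (adeg≡value K v)))

  value-single : ∀ K (i : Fin (suc K)) c → value K (single i c) ≡ c * weight i
  value-single zero zero c = +-identityʳ (c * 1)
  value-single (suc K) zero c = trans (cong (c * 2 ^ suc K +_) (value-one K)) (+-identityʳ _)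
    where
    value-one : ∀ K → value K one ≡ 0
    value-one zero = refl
    value-one (suc K) = value-one K
  value-single (suc K) (suc i) c = value-single K i c

  weight-first : ∀ K → weight {K} zero ≡ 2 ^ K
  weight-first zero = refl
  weight-first (suc K) = refl

  weight-last : ∀ K → weight (fromℕ K) ≡ 1
  weight-last zero = refl
  weight-last (suc K) = weight-last K

  weight-halves : ∀ {K} (i : Fin K) → weight (inject₁ i) ≡ 2 * weight (suc i)
  weight-halves {suc K} zero = cong (2 *_) (sym (weight-first K))
  weight-halves {suc K} (suc i) = weight-halves i

  weight-≤ : ∀ {K} (i : Fin (suc K)) → weight i ≤ 2 ^ K
  weight-≤ {zero} zero = ≤-refl
  weight-≤ {suc K} zero = ≤-refl
  weight-≤ {suc K} (suc i) = ≤-trans (weight-≤ i) (^-monoʳ-≤ 2 (n≤1+n K))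

  weight-nonZero : ∀ {K} (i : Fin (suc K)) → NonZero (weight i)
  weight-nonZero {zero} zero = _
  weight-nonZero {suc K} zero = m^n≢0 2 (suc K)
  weight-nonZero {suc K} (suc i) = weight-nonZero i

  weight-injective : ∀ {K} (i j : Fin (suc K)) → weight i ≡ weight j → i ≡ j
  weight-injective {zero} zero zero _ = refl
  weight-injective {suc K} zero zero _ = refl
  weight-injective {suc K} zero (suc j) eq = ⊥-elim (<⇒≢ (later-smaller j) (sym eq))
    where
    later-smaller : ∀ j → weight {K} j < 2 ^ suc K
    later-smaller j = ≤-<-trans (weight-≤ j) (^-monoʳ-< 2 (s≤s (s≤s z≤n)) (n<1+n K))
  weight-injective {suc K} (suc i) zero eq = sym (weight-injective zero (suc i) (sym eq))
  weight-injective {suc K} (suc i) (suc j) eq = cong suc (weight-injective i j eq)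

  lookup-configuration : ∀ K (i : Fin (suc K)) → lookup (configuration K) i ≡ weight i ∷ []
  lookup-configuration zero zero = refl
  lookup-configuration (suc K) zero = refl
  lookup-configuration (suc K) (suc i) = lookup-configuration K i

  configuration-injective : ∀ K (i j : Fin (suc K)) → lookup (configuration K) i ≡ lookup (configuration K) j → i ≡ j
  configuration-injective K i j eq = weight-injective i j
    (cong head (trans (sym (lookup-configuration K i)) (trans eq (lookup-configuration K j))))

  value-+ᵥ : ∀ K u v → value K (u +ᵥ v) ≡ value K u + value K v
  value-+ᵥ K u v = cong head (begin
    value K (u +ᵥ v) ∷ []                              ≡⟨ sym (adeg≡value K (u +ᵥ v)) ⟩
    adeg (configuration K) (u +ᵥ v)                    ≡⟨ adeg-+ᵥ (configuration K) u v ⟩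
    adeg (configuration K) u +ᵥ adeg (configuration K) v ≡⟨ cong₂ _+ᵥ_ (adeg≡value K u) (adeg≡value K v) ⟩
    (value K u + value K v) ∷ []                       ∎)
    where open ≡-Reasoning

  value-last-power : ∀ K j → value K (single (fromℕ K) j) ≡ j
  value-last-power K j = trans (value-single K (fromℕ K) j) (trans (cong (j *_) (weight-last K)) (*-identityʳ j))

  n<2^n : ∀ n → n < 2 ^ n
  n<2^n zero = s≤s z≤n
  n<2^n (suc n) = begin-strict
    suc n           <⟨ s≤s (n<2^n n) ⟩
    suc (2 ^ n)     ≡⟨ +-comm 1 (2 ^ n) ⟩
    2 ^ n + 1       ≤⟨ +-monoʳ-≤ (2 ^ n) (m^n>0 2 n) ⟩
    2 ^ n + 2 ^ n   ≡⟨ cong (2 ^ n +_) (sym (+-identityʳ (2 ^ n))) ⟩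
    2 ^ suc n       ∎
    where open ≤-Reasoning

  Binary : ∀ {k} → Vec ℕ k → Set
  Binary = All (_≤ 1)

  value-binary : ∀ K u → Binary u → value K u < 2 ^ suc K
  value-binary zero (a ∷ []) (a≤1 ∷ []) = s≤s (≤-trans (≤-reflexive (trans (+-identityʳ _) (*-identityʳ a))) a≤1)
  value-binary (suc K) (a ∷ u) (a≤1 ∷ bin) = begin-strict
    a * 2 ^ suc K + value K u <⟨ +-monoʳ-< (a * 2 ^ suc K) (value-binary K u bin) ⟩
    a * 2 ^ suc K + 2 ^ suc K ≤⟨ +-monoˡ-≤ (2 ^ suc K) (*-monoˡ-≤ (2 ^ suc K) a≤1) ⟩
    1 * 2 ^ suc K + 2 ^ suc K ≡⟨ +-comm (1 * 2 ^ suc K) (2 ^ suc K) ⟩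
    2 ^ suc (suc K)           ∎
    where open ≤-Reasoning

  quotient-unique : ∀ B .{{_ : NonZero B}} {a a′ r r′} → r < B → r′ < B → a * B + r ≡ a′ * B + r′ → a ≡ a′
  quotient-unique B {a} {a′} {r} {r′} r<B r′<B eq = begin
    a                 ≡⟨ sym (quotient a r r<B) ⟩
    (a * B + r) / B   ≡⟨ cong (_/ B) eq ⟩
    (a′ * B + r′) / B ≡⟨ quotient a′ r′ r′<B ⟩
    a′                ∎
    where
    open ≡-Reasoning
    quotient : ∀ a r → r < B → (a * B + r) / B ≡ a
    quotient a r r<B = trans (+-distrib-/-∣ˡ r (n∣m*n a))
      (trans (cong₂ _+_ (m*n/n≡m a B) (m<n⇒m/n≡0 r<B)) (+-identityʳ a))

  normalForm-unique : ∀ K (u v : Mon (suc K)) → Binary (tail u) → Binary (tail v) → value K u ≡ value K v → u ≡ v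
  normalForm-unique zero (a ∷ []) (b ∷ []) _ _ eq = cong (_∷ [])
    (trans (sym (trans (+-identityʳ _) (*-identityʳ a))) (trans eq (trans (+-identityʳ _) (*-identityʳ b))))
  normalForm-unique (suc K) (a ∷ u) (b ∷ v) bin-u bin-v eq
    with quotient-unique (2 ^ suc K) {{m^n≢0 2 (suc K)}} {a} {b} (value-binary K u bin-u) (value-binary K v bin-v) eq
  ... | refl = cong (a ∷_) (normalForm-unique K u v (tail-binary bin-u) (tail-binary bin-v) (+-cancelˡ-≡ _ _ _ eq))
    where
    tail-binary : ∀ {k} {w : Vec ℕ (suc k)} → Binary w → Binary (tail w)
    tail-binary (_ ∷ bin) = bin

  move : ∀ {K} → Fin K → Binom (suc K)
  move i = single (suc i) 2 , single (inject₁ i) 1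

  moves : ∀ K → List (Binom (suc K))
  moves K = tabulate move

  move-adeg : ∀ K (i : Fin K) → adeg (configuration K) (proj₁ (move i)) ≡ adeg (configuration K) (proj₂ (move i))
  move-adeg K i = value⇒SameADeg K (begin
    value K (single (suc i) 2)       ≡⟨ value-single K (suc i) 2 ⟩
    2 * weight (suc i)               ≡⟨ sym (weight-halves i) ⟩
    weight (inject₁ i)               ≡⟨ sym (*-identityˡ _) ⟩
    1 * weight (inject₁ i)           ≡⟨ sym (value-single K (inject₁ i) 1) ⟩
    value K (single (inject₁ i) 1)   ∎)
    where open ≡-Reasoning

  move-degree : ∀ {K} (i : Fin K) → degB (move i) ≡ 2
  move-degree i = cong₂ _⊔_ (deg-single (suc i) 2) (deg-single (inject₁ i) 1)

  degS-moves : ∀ N → degS (moves (suc N)) ≡ 2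
  degS-moves N = degS-tabulate (move {suc N}) move-degree

  moves-adeg : ∀ K {u v} → (u , v) ∈ moves K → adeg (configuration K) u ≡ adeg (configuration K) v
  moves-adeg K uv∈ with ∈-tabulate⁻ uv∈
  ... | i , refl = move-adeg K i

  carry : ∀ K (u : Mon (suc K)) → Binary (tail u) ⊎ ∃₂ λ (i : Fin K) t → u ≡ t +ᵥ single (suc i) 2
  carry zero (a ∷ []) = inj₁ []
  carry (suc K) (a ∷ b ∷ u) with b ≤? 1
  ... | no b≰1 = inj₂ (zero , (a ∷ (b ∸ 2) ∷ u) ,
          cong₂ _∷_ (sym (+-identityʳ a)) (cong₂ _∷_ (sym (m∸n+n≡m (≰⇒> b≰1))) (sym (+ᵥ-identityʳ u))))
  ... | yes b≤1 with carry K (b ∷ u)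
  ...   | inj₁ bin = inj₁ (b≤1 ∷ bin)
  ...   | inj₂ (i , t , eq) = inj₂ (suc i , (a ∷ t) , cong₂ _∷_ (sym (+-identityʳ a)) eq)

  -- every monomial is connected by moves to one whose later digits are
  -- binary; n bounds the degree, which every move lowers by one
  normalise : ∀ K n (u : Mon (suc K)) → deg u ≤ n → ∃[ v ] (Binary (tail v) × Connected (_∈ moves K) u v)
  normalise K n u deg≤n with carry K u
  normalise K n u deg≤n | inj₁ bin = u , bin , ~-refl
  normalise K zero _ deg≤0 | inj₂ (i , t , refl)
    with () ← ≤-trans (m≤n+m 2 (deg t)) (≤-trans (≤-reflexive (sym (deg-+single t (suc i) 2))) deg≤0)
  normalise K (suc n) _ deg≤ | inj₂ (i , t , refl)
    with normalise K n (t +ᵥ single (inject₁ i) 1) (lowered deg≤)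
    where
    lowered : deg (t +ᵥ single (suc i) 2) ≤ suc n → deg (t +ᵥ single (inject₁ i) 1) ≤ n
    lowered d≤ = s≤s⁻¹ (begin
      suc (deg (t +ᵥ single (inject₁ i) 1)) ≡⟨ cong suc (deg-+single t (inject₁ i) 1) ⟩
      suc (deg t + 1)                       ≡⟨ sym (+-suc (deg t) 1) ⟩
      deg t + 2                             ≡⟨ sym (deg-+single t (suc i) 2) ⟩
      deg (t +ᵥ single (suc i) 2)           ≤⟨ d≤ ⟩
      suc n                                 ∎)
      where open ≤-Reasoning
  ... | v , bin , lowered~v = v , bin , ~-trans (~-step (∈-tabulate⁺ i) t) lowered~v

  moves-connect : ∀ K u v → adeg (configuration K) u ≡ adeg (configuration K) v → Connected (_∈ moves K) u v
  moves-connect K u v eq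
    with normalise K (deg u) u ≤-refl | normalise K (deg v) v ≤-refl
  ... | u′ , bin-u′ , u~u′ | v′ , bin-v′ , v~v′
    with normalForm-unique K u′ v′ bin-u′ bin-v′ (SameADeg⇒value K (begin
      adeg (configuration K) u′ ≡⟨ sym (Connected⇒adeg (configuration K) (moves-adeg K) u~u′) ⟩
      adeg (configuration K) u  ≡⟨ eq ⟩
      adeg (configuration K) v  ≡⟨ Connected⇒adeg (configuration K) (moves-adeg K) v~v′ ⟩
      adeg (configuration K) v′ ∎))
    where open ≡-Reasoning
  ... | refl = ~-trans u~u′ (~-sym v~v′)

-- The lexicographic term order with x₀ > x₁ > … > x_K.
module LexOrder where
  open import Data.Nat using (zero; suc; _<_; _≤_; z≤n; s≤s)
  open import Data.Nat.Properties using (<-trans; <-asym; <-irrefl; <-cmp; +-monoˡ-<)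
  open import Data.Fin using (zero; suc; inject₁; fromℕ)
  open import Data.Vec using ([]; _∷_)
  open import Data.Product using (_,_)
  open import Data.Sum using (_⊎_; inj₁; inj₂)
  open import Data.Empty using (⊥-elim)
  open import Relation.Nullary using (¬_)
  open import Relation.Binary using (tri<; tri≈; tri>)
  open import Relation.Binary.PropositionalEquality using (refl; cong)
  open Monomials

  data Lex : ∀ {k} → Mon k → Mon k → Set where
    lex-[] : Lex [] []
    lex-<  : ∀ {k a b} {u v : Mon k} → a < b → Lex (a ∷ u) (b ∷ v)
    lex-≡  : ∀ {k a} {u v : Mon k} → Lex u v → Lex (a ∷ u) (a ∷ v)

  Lex-refl : ∀ {k} (u : Mon k) → Lex u u
  Lex-refl [] = lex-[]
  Lex-refl (a ∷ u) = lex-≡ (Lex-refl u)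

  Lex-trans : ∀ {k} {u v w : Mon k} → Lex u v → Lex v w → Lex u w
  Lex-trans lex-[] lex-[] = lex-[]
  Lex-trans (lex-< a<b) (lex-< b<c) = lex-< (<-trans a<b b<c)
  Lex-trans (lex-< a<b) (lex-≡ _) = lex-< a<b
  Lex-trans (lex-≡ _) (lex-< b<c) = lex-< b<c
  Lex-trans (lex-≡ u≤v) (lex-≡ v≤w) = lex-≡ (Lex-trans u≤v v≤w)

  Lex-antisym : ∀ {k} {u v : Mon k} → Lex u v → Lex v u → u ≡ v
  Lex-antisym lex-[] lex-[] = refl
  Lex-antisym (lex-< a<b) (lex-< b<a) = ⊥-elim (<-asym a<b b<a)
  Lex-antisym (lex-< a<a) (lex-≡ _) = ⊥-elim (<-irrefl refl a<a)
  Lex-antisym (lex-≡ _) (lex-< a<a) = ⊥-elim (<-irrefl refl a<a)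
  Lex-antisym (lex-≡ u≤v) (lex-≡ v≤u) = cong (_ ∷_) (Lex-antisym u≤v v≤u)

  Lex-total : ∀ {k} (u v : Mon k) → Lex u v ⊎ Lex v u
  Lex-total [] [] = inj₁ lex-[]
  Lex-total (a ∷ u) (b ∷ v) with <-cmp a b
  ... | tri< a<b _ _ = inj₁ (lex-< a<b)
  ... | tri> _ _ b<a = inj₂ (lex-< b<a)
  ... | tri≈ _ refl _ with Lex-total u v
  ...   | inj₁ u≤v = inj₁ (lex-≡ u≤v)
  ...   | inj₂ v≤u = inj₂ (lex-≡ v≤u)

  Lex-compatible : ∀ {k} (u v w : Mon k) → Lex u v → Lex (u +ᵥ w) (v +ᵥ w)
  Lex-compatible [] [] [] lex-[] = lex-[]
  Lex-compatible (a ∷ u) (b ∷ v) (c ∷ w) (lex-< a<b) = lex-< (+-monoˡ-< c a<b)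
  Lex-compatible (a ∷ u) (.a ∷ v) (c ∷ w) (lex-≡ u≤v) = lex-≡ (Lex-compatible u v w u≤v)

  Lex-one-least : ∀ {k} (u : Mon k) → Lex one u
  Lex-one-least [] = lex-[]
  Lex-one-least (zero ∷ u) = lex-≡ (Lex-one-least u)
  Lex-one-least (suc a ∷ u) = lex-< (s≤s z≤n)

  below-last-power : ∀ K {w : Mon (suc K)} {j} → Lex w (single (fromℕ K) j) → ∃[ j′ ] w ≡ single (fromℕ K) j′
  below-last-power zero {a ∷ []} _ = a , refl
  below-last-power (suc K) {a ∷ w} (lex-≡ w≤) with below-last-power K w≤
  ... | j′ , refl = j′ , refl

  last-power-below : ∀ {K} j (i : Fin K) c → 1 ≤ c → Lex (single (fromℕ K) j) (single (inject₁ i) c)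
  last-power-below j zero (suc c) _ = lex-< (s≤s z≤n)
  last-power-below j (suc i) c 1≤c = lex-≡ (last-power-below j i c 1≤c)

  ¬-below-last-power : ∀ {K} j (i : Fin K) c → 1 ≤ c → ¬ Lex (single (inject₁ i) c) (single (fromℕ K) j)
  ¬-below-last-power j zero (suc c) _ (lex-< ())
  ¬-below-last-power j (suc i) c 1≤c (lex-≡ below) = ¬-below-last-power j i c 1≤c below

  classify : ∀ K (u : Mon (suc K)) →
    (∃[ i ] single (inject₁ i) 1 ∣ₘ u) ⊎ (∃[ j ] u ≡ single (fromℕ K) j)
  classify zero (j ∷ []) = inj₂ (j , refl)
  classify (suc K) (zero ∷ u) with classify K u
  ... | inj₁ (i , xᵢ∣u) = inj₁ (suc i , λ { zero → z≤n ; (suc k) → xᵢ∣u k })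
  ... | inj₂ (j , refl) = inj₂ (j , refl)
  classify (suc K) (suc a ∷ u) = inj₁ (zero , λ { zero → s≤s z≤n ; (suc k) → one-∣ₘ u k })

module TabulatedLists where
  open import Data.Nat using (suc)
  open import Data.Fin using (zero; suc; cast; toℕ)
  open import Data.Fin.Properties using (toℕ-cast; toℕ-injective)
  open import Data.List using (tabulate; length) renaming (lookup to lookupₗ)
  open import Data.List.Properties using (length-tabulate)
  open import Function using (_∘_)
  open import Relation.Binary.PropositionalEquality using (refl; sym; trans; cong)

  position : ∀ {a} {X : Set a} {k} (f : Fin k → X) → Fin (length (tabulate f)) → Fin k
  position f = cast (length-tabulate f)

  lookup-tabulate′ : ∀ {a} {X : Set a} {k} (f : Fin k → X) i → lookupₗ (tabulate f) i ≡ f (position f i)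
  lookup-tabulate′ {k = suc k} f zero = refl
  lookup-tabulate′ {k = suc k} f (suc i) = lookup-tabulate′ (f ∘ suc) i

  position-injective : ∀ {a} {X : Set a} {k} (f : Fin k → X) {i j} → position f i ≡ position f j → i ≡ j
  position-injective f {i} {j} eq = toℕ-injective
    (trans (sym (toℕ-cast (length-tabulate f) i)) (trans (cong toℕ eq) (toℕ-cast (length-tabulate f) j)))

module PowersOfTwoIdeal {c ℓ} (F : Field c ℓ) (K : ℕ) where
  import Data.Nat as ℕ
  import Data.Nat.Properties as ℕ
  open import Data.Fin using (zero; suc; inject₁; fromℕ; cast)
  import Data.Fin.Properties as Fin
  open import Data.Vec using (Vec; []; _∷_; lookup)
  open import Data.Vec.Properties using (≡-dec)
  open import Data.List using ([]; _∷_; tabulate) renaming (lookup to lookupₗ)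
  open import Data.List.Properties using (lookup-tabulate; length-tabulate)
  open import Data.List.Membership.Propositional using (_∈_)
  open import Data.List.Membership.Propositional.Properties using (∈-tabulate⁺; ∈-tabulate⁻)
  open import Data.Product using (_,_; proj₁; proj₂)
  open import Data.Sum using (_⊎_; inj₁; inj₂; [_,_]′)
  open import Data.Empty using (⊥; ⊥-elim)
  open import Function using (_∘_)
  open import Relation.Nullary using (¬_; yes; no)
  open import Relation.Nullary.Negation using (contradiction)
  import Relation.Binary.PropositionalEquality as ≡
  open Monomials
  open PowersOfTwo
  open LexOrder
  open TabulatedLists
  open DoubleNegation
  open Field F hiding (zero)
  open Polynomials F (ℕ.suc K)
  open Toric (configuration K)
  open FormalSums F (ℕ.suc K)
  open ToricIdeals F (configuration K)

  moves-generate : Generates (moves K)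
  moves-generate = generates-if-connected (moves K) (moves-adeg K) (moves-connect K)

  -- xᵢ occurs in the move x_(i+1)² − xᵢ and in no multiple of another move
  moves-isolated : Isolated (moves K)
  moves-isolated b∈moves with ∈-tabulate⁻ b∈moves
  ... | i , ≡.refl = single (inject₁ i) 1 , -1≉0 ∘ trans (sym (coeff-binom-right _ _ move-nontrivial)) , avoids
    where
    move-nontrivial : ¬ single (suc i) 2 ≡ single (inject₁ i) 1
    move-nontrivial eq with ≡.trans (≡.sym (deg-single (suc i) 2)) (≡.trans (≡.cong deg eq) (deg-single (inject₁ i) 1))
    ... | ()

    avoids : ∀ {b′} → b′ ∈ moves K → ¬ b′ ≡ move i → Avoids b′ (single (inject₁ i) 1)
    avoids b′∈moves b′≢move with ∈-tabulate⁻ b′∈moves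
    ... | j , ≡.refl = λ t → too-large t , wrong-variable t
      where
      too-large : ∀ t → ¬ t +ᵥ single (suc j) 2 ≡ single (inject₁ i) 1
      too-large t eq = ℕ.<⇒≢ (ℕ.m≤n+m 2 (deg t))
        (≡.sym (≡.trans (≡.sym (deg-+single t (suc j) 2)) (≡.trans (≡.cong deg eq) (deg-single (inject₁ i) 1))))

      wrong-variable : ∀ t → ¬ t +ᵥ single (inject₁ j) 1 ≡ single (inject₁ i) 1
      wrong-variable t eq = ℕ.m+1+n≢0 (lookup t (inject₁ j))
        (≡.trans (≡.sym (lookup-+single t (inject₁ j) 1))
          (≡.trans (≡.cong (λ w → lookup w (inject₁ j)) eq)
            (lookup-single-≢ (inject₁ i) (inject₁ j) 1 (b′≢move ∘ ≡.cong move ∘ Fin.inject₁-injective))))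

  moves-markov : IsMarkovBasis (moves K)
  moves-markov = markov-if-isolated (moves K) moves-generate moves-isolated

  lex : TermOrder
  lex = record
    { _≼_ = Lex
    ; isTotal = record
      { isPartialOrder = record
        { isPreorder = record
          { isEquivalence = ≡.isEquivalence
          ; reflexive = λ { ≡.refl → Lex-refl _ }
          ; trans = Lex-trans }
        ; antisym = Lex-antisym }
      ; total = Lex-total }
    ; compatible = Lex-compatible
    ; one-least = Lex-one-least }

  gröbner : Fin K → Binom (ℕ.suc K)
  gröbner i = single (inject₁ i) 1 , single (fromℕ K) (weight (inject₁ i))

  gröbner-adeg : ∀ i → SameADeg (gröbner i)
  gröbner-adeg i = value⇒SameADeg K (begin
    value K (single (inject₁ i) 1)                       ≡⟨ value-single K (inject₁ i) 1 ⟩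
    1 ℕ.* weight (inject₁ i)                             ≡⟨ ℕ.*-identityˡ _ ⟩
    weight (inject₁ i)                                   ≡⟨ ≡.sym (value-last-power K _) ⟩
    value K (single (fromℕ K) (weight (inject₁ i)))      ∎)
    where open ≡.≡-Reasoning

  gröbner-nontrivial : ∀ i → ¬ proj₁ (gröbner i) ≡ proj₂ (gröbner i)
  gröbner-nontrivial i eq = ¬-below-last-power _ i 1 ℕ.≤-refl (≡.subst (Lex _) eq (Lex-refl _))

  gröbner-init : ∀ i → IsInit lex (binom (gröbner i)) (single (inject₁ i) 1)
  gröbner-init i = 1≉0 ∘ trans (sym (coeff-binom-left _ _ (gröbner-nontrivial i))) , below
    where
    below : ∀ v → ¬ coeff (binom (gröbner i)) v ≈ 0# → Lex v (single (inject₁ i) 1)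
    below v nonzero with binom-support (proj₁ (gröbner i)) (proj₂ (gröbner i)) v nonzero
    ... | inj₁ ≡.refl = Lex-refl _
    ... | inj₂ ≡.refl = last-power-below _ i 1 ℕ.≤-refl

  gröbner-init-unique : ∀ i u → IsInit lex (binom (gröbner i)) u → u ≡ single (inject₁ i) 1
  gröbner-init-unique i u (nonzero , maximal) with binom-support (proj₁ (gröbner i)) (proj₂ (gröbner i)) u nonzero
  ... | inj₁ u≡xᵢ = u≡xᵢ
  ... | inj₂ ≡.refl = ⊥-elim (¬-below-last-power _ i 1 ℕ.≤-refl (maximal _ (proj₁ (gröbner-init i))))

  -- A nonzero element of I_A never has a power of x_K as leading term:
  -- all its other terms would be powers of x_K of different A-degree, so
  -- the leading coefficient would be the whole pairing with its fibre.
  init-not-last-power : ∀ f j → InIA f → ¬ IsInit lex f (single (fromℕ K) j)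
  init-not-last-power f j f∈IA (nonzero , maximal) =
    ¬¬-zipWith (λ f≈0 f≈u → nonzero (trans (sym u-term) (trans (sym f≈u) f≈0)))
      (IA-fibre-¬¬ d f f∈IA) (pairing-cong-¬¬ (fibre d) f ((cf , u) ∷ []) agree) (λ ())
    where
    u : Mon (ℕ.suc K)
    u = single (fromℕ K) j
    d : Vec ℕ 1
    d = adeg (configuration K) u
    cf : Carrier
    cf = coeff f u

    u-term : pairing (fibre d) ((cf , u) ∷ []) ≈ cf
    u-term = trans (+-identityʳ _) (trans (*-congˡ (fibre-≡ ≡.refl)) (*-identityʳ cf))

    agree : Agree (fibre d) f ((cf , u) ∷ [])
    agree w with ≡-dec ℕ._≟_ w u
    ... | yes ≡.refl = contradiction (*-congʳ (sym (coeff-term cf u)))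
    ... | no w≢u = λ ¬agree → ¬agree (trans (term-zero ¬agree) (sym q-side-zero))
      where
      q-side-zero : coeff ((cf , u) ∷ []) w * fibre d w ≈ 0#
      q-side-zero = trans (*-congʳ (reflexive (coeff-cons-≢ cf [] (w≢u ∘ ≡.sym)))) (zeroˡ _)

      -- if agreement fails, x^w is a term of f, hence a power of x_K below
      -- u, hence outside the fibre of u
      term-zero : ¬ coeff f w * fibre d w ≈ coeff ((cf , u) ∷ []) w * fibre d w → coeff f w * fibre d w ≈ 0#
      term-zero ¬agree
        with below-last-power K (maximal w (λ fw≈0 → ¬agree (trans (*-congʳ fw≈0) (trans (zeroˡ _) (sym q-side-zero)))))
      ... | j′ , ≡.refl = trans (*-congˡ (fibre-≢ other-fibre)) (zeroʳ _)
        where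
        other-fibre : ¬ adeg (configuration K) w ≡ d
        other-fibre eq = w≢u (≡.cong (single (fromℕ K))
          (≡.trans (≡.sym (value-last-power K j′)) (≡.trans (SameADeg⇒value K eq) (value-last-power K j))))

  G : List Poly
  G = tabulate (binom ∘ gröbner)

  lookup-G : ∀ k → lookupₗ G k ≡ binom (gröbner (position (binom ∘ gröbner) k))
  lookup-G = lookup-tabulate′ (binom ∘ gröbner)

  leading-terms-independent : ∀ k l u w → ¬ k ≡ l → IsInit lex (lookupₗ G k) u →
    ¬ coeff (lookupₗ G l) w ≈ 0# → ¬ u ∣ₘ w
  leading-terms-independent k l u w k≢l init nonzero
    rewrite lookup-G k | lookup-G l
    with gröbner-init-unique (position _ k) u init
       | binom-support (proj₁ (gröbner (position _ l))) (proj₂ (gröbner (position _ l))) w nonzero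
  ... | ≡.refl | inj₁ ≡.refl = single-∤ (inject₁ (position _ k)) (single (inject₁ (position _ l)) 1)
          (lookup-single-≢ _ _ 1 (k≢l ∘ position-injective (binom ∘ gröbner) ∘ Fin.inject₁-injective))
  ... | ≡.refl | inj₂ ≡.refl = single-∤ (inject₁ (position _ k)) (proj₂ (gröbner (position _ l)))
          (lookup-single-≢ (fromℕ K) _ _ (Fin.fromℕ≢inject₁ ∘ ≡.sym))

  G-reduced : IsReducedGB lex G
  G-reduced = G⊆IA , G-init , G-divides , G-monic , leading-terms-independent
    where
    G⊆IA : ∀ {g} → g ∈ G → InIA g
    G⊆IA g∈G with ∈-tabulate⁻ g∈G
    ... | i , ≡.refl = SameADeg⇒binom∈IA (gröbner-adeg i)

    G-init : ∀ {g} → g ∈ G → ∃[ u ] IsInit lex g u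
    G-init g∈G with ∈-tabulate⁻ g∈G
    ... | i , ≡.refl = single (inject₁ i) 1 , gröbner-init i

    G-divides : ∀ f u → InIA f → IsInit lex f u →
      ∃[ k ] ∃[ w ] (IsInit lex (lookupₗ G k) w × w ∣ₘ u)
    G-divides f u f∈IA init with classify K u
    ... | inj₁ (i , xᵢ∣u) = cast (≡.sym (length-tabulate (binom ∘ gröbner))) i , single (inject₁ i) 1 ,
          ≡.subst (λ g → IsInit lex g (single (inject₁ i) 1))
            (≡.sym (lookup-tabulate (binom ∘ gröbner) i)) (gröbner-init i) ,
          xᵢ∣u
    ... | inj₂ (j , ≡.refl) = ⊥-elim (init-not-last-power f j f∈IA init)

    G-monic : ∀ k u → IsInit lex (lookupₗ G k) u → coeff (lookupₗ G k) u ≈ 1#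
    G-monic k u init rewrite lookup-G k with gröbner-init-unique (position _ k) u init
    ... | ≡.refl = coeff-binom-left _ _ (gröbner-nontrivial (position _ k))

  gröbner-universal : ∀ i → InUniversalGB (binom (gröbner i))
  gröbner-universal i = lex , G , G-reduced , ∈-tabulate⁺ i

  gröbner-irreducible : ∀ i → Irreducible (gröbner i)
  gröbner-irreducible i r with r Fin.≟ inject₁ i
  ... | yes ≡.refl = inj₂ (lookup-single-≢ (fromℕ K) (inject₁ i) _ (Fin.fromℕ≢inject₁ ∘ ≡.sym))
  ... | no r≢xᵢ = inj₁ (lookup-single-≢ (inject₁ i) r 1 r≢xᵢ)

  value-xᵢ-x_K : ∀ (i : Fin K) a b → value K (single (inject₁ i) a +ᵥ single (fromℕ K) b) ≡ a ℕ.* weight (inject₁ i) ℕ.+ b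
  value-xᵢ-x_K i a b = ≡.trans (value-+ᵥ K _ _) (≡.cong₂ ℕ._+_ (value-single K (inject₁ i) a) (value-last-power K b))

  gröbner-primitive : ∀ i → IsPrimitive (gröbner i)
  gröbner-primitive i = SameADeg⇒binom∈IA (gröbner-adeg i) , gröbner-irreducible i , gröbner-nontrivial i , maximal
    where
    W : ℕ
    W = weight (inject₁ i)
    maximal : ∀ w z → BinInIA (w , z) → NonzeroB (w , z) →
      w ∣ₘ single (inject₁ i) 1 → z ∣ₘ single (fromℕ K) W → (w , z) ≡ gröbner i
    maximal w z wz∈IA w≢z w∣ z∣ with ∣ₘ-single w _ 1 w∣ | ∣ₘ-single z _ W z∣
    ... | w≡ , a≤1 | z≡ , _ = powers (lookup w (inject₁ i)) (lookup z (fromℕ K)) a≤1 same-value w≡ z≡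
      where
      same-value : lookup w (inject₁ i) ℕ.* W ≡ lookup z (fromℕ K)
      same-value = ≡.trans (≡.sym (≡.trans (≡.cong (value K) w≡) (value-single K (inject₁ i) _)))
        (≡.trans (SameADeg⇒value K (binom∈IA⇒SameADeg wz∈IA)) (≡.trans (≡.cong (value K) z≡) (value-last-power K _)))

      powers : ∀ a b → a ℕ.≤ 1 → a ℕ.* W ≡ b → w ≡ single (inject₁ i) a → z ≡ single (fromℕ K) b → (w , z) ≡ gröbner i
      powers 0 b _ 0≡b w≡ z≡ = contradiction
        (≡.trans w≡ (≡.trans (single-0 _) (≡.sym (≡.trans z≡ (≡.trans (≡.cong (single _) (≡.sym 0≡b)) (single-0 _)))))) w≢z
      powers 1 b _ W+0≡b w≡ z≡ = ≡.cong₂ _,_ w≡ (≡.trans z≡ (≡.cong (single _) (≡.trans (≡.sym W+0≡b) (ℕ.+-identityʳ W))))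
      powers (ℕ.suc (ℕ.suc a)) b (ℕ.s≤s ()) _ _ _

  gröbner-support : ∀ i r → InSupp (gröbner i) r → r ≡ inject₁ i ⊎ r ≡ fromℕ K
  gröbner-support i r r∈supp with r Fin.≟ inject₁ i | r Fin.≟ fromℕ K
  ... | yes r≡p | _ = inj₁ r≡p
  ... | no _ | yes r≡q = inj₂ r≡q
  ... | no r≢p | no r≢q with r∈supp
  ...   | inj₁ ≢0 = contradiction (lookup-single-≢ (inject₁ i) r 1 r≢p) ≢0
  ...   | inj₂ ≢0 = contradiction (lookup-single-≢ (fromℕ K) r _ r≢q) ≢0

  -- A nonzero binomial of I_A involving only xᵢ and x_K involves both:
  -- the A-degree a·2^(K−i) + b determines the exponents of either variable
  -- from those of the other.
  two-variable-binomial : ∀ i w z → BinInIA (w , z) → NonzeroB (w , z) →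
    (∀ r → InSupp (w , z) r → r ≡ inject₁ i ⊎ r ≡ fromℕ K) →
    InSupp (w , z) (inject₁ i) × InSupp (w , z) (fromℕ K)
  two-variable-binomial i w z wz∈IA w≢z support = involves-p , involves-q
    where
    p q : Fin (ℕ.suc K)
    p = inject₁ i
    q = fromℕ K
    W : ℕ
    W = weight p
    p≢q : ¬ p ≡ q
    p≢q = Fin.fromℕ≢inject₁ ∘ ≡.sym

    only-p-q : ∀ v → (∀ {r} → ¬ lookup v r ≡ 0 → InSupp (w , z) r) → ∀ r → ¬ r ≡ p → ¬ r ≡ q → lookup v r ≡ 0
    only-p-q v v∈supp r r≢p r≢q with lookup v r ℕ.≟ 0
    ... | yes ≡0 = ≡0
    ... | no ≢0 = [ contradiction′ r≢p , contradiction′ r≢q ]′ (support r (v∈supp ≢0))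
      where
      contradiction′ : ∀ {s} → ¬ r ≡ s → r ≡ s → lookup v r ≡ 0
      contradiction′ r≢s r≡s = contradiction r≡s r≢s

    w≡ : w ≡ single p (lookup w p) +ᵥ single q (lookup w q)
    w≡ = two-variables w p q p≢q (only-p-q w inj₁)

    z≡ : z ≡ single p (lookup z p) +ᵥ single q (lookup z q)
    z≡ = two-variables z p q p≢q (only-p-q z inj₂)

    same-value : lookup w p ℕ.* W ℕ.+ lookup w q ≡ lookup z p ℕ.* W ℕ.+ lookup z q
    same-value = ≡.trans (≡.sym (≡.trans (≡.cong (value K) w≡) (value-xᵢ-x_K i _ _)))
      (≡.trans (SameADeg⇒value K (binom∈IA⇒SameADeg wz∈IA)) (≡.trans (≡.cong (value K) z≡) (value-xᵢ-x_K i _ _)))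

    w≢z′ : lookup w p ≡ lookup z p → lookup w q ≡ lookup z q → ⊥
    w≢z′ eq-p eq-q = w≢z (≡.trans w≡ (≡.trans (≡.cong₂ (λ a b → single p a +ᵥ single q b) eq-p eq-q) (≡.sym z≡)))

    involves-p : InSupp (w , z) p
    involves-p with lookup w p ℕ.≟ 0 | lookup z p ℕ.≟ 0
    ... | no ≢0 | _ = inj₁ ≢0
    ... | yes _ | no ≢0 = inj₂ ≢0
    ... | yes w≡0 | yes z≡0 = ⊥-elim (w≢z′ (≡.trans w≡0 (≡.sym z≡0))
           (ℕ.+-cancelˡ-≡ (0 ℕ.* W) _ _
             (≡.subst₂ (λ a b → a ℕ.* W ℕ.+ lookup w q ≡ b ℕ.* W ℕ.+ lookup z q) w≡0 z≡0 same-value)))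

    involves-q : InSupp (w , z) q
    involves-q with lookup w q ℕ.≟ 0 | lookup z q ℕ.≟ 0
    ... | no ≢0 | _ = inj₁ ≢0
    ... | yes _ | no ≢0 = inj₂ ≢0
    ... | yes w≡0 | yes z≡0 = ⊥-elim (w≢z′
           (ℕ.*-cancelʳ-≡ _ _ W {{weight-nonZero p}} (≡.trans (≡.sym (ℕ.+-identityʳ _))
             (≡.trans (≡.subst₂ (λ a b → lookup w p ℕ.* W ℕ.+ a ≡ lookup z p ℕ.* W ℕ.+ b) w≡0 z≡0 same-value)
                      (ℕ.+-identityʳ _))))
           (≡.trans w≡0 (≡.sym z≡0)))

  gröbner-circuit : ∀ i → IsCircuit (gröbner i)
  gröbner-circuit i = SameADeg⇒binom∈IA (gröbner-adeg i) , gröbner-irreducible i , gröbner-nontrivial i , minimal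
    where
    minimal : ∀ b′ → BinInIA b′ → Irreducible b′ → NonzeroB b′ →
      (∀ r → InSupp b′ r → InSupp (gröbner i) r) → ∀ r → InSupp (gröbner i) r → InSupp b′ r
    minimal (w , z) wz∈IA _ w≢z supp⊆ r r∈supp =
      [ (λ r≡p → ≡.subst (InSupp (w , z)) (≡.sym r≡p) (proj₁ both)) ,
        (λ r≡q → ≡.subst (InSupp (w , z)) (≡.sym r≡q) (proj₂ both)) ]′ (gröbner-support i r r∈supp)
      where
      both : InSupp (w , z) (inject₁ i) × InSupp (w , z) (fromℕ K)
      both = two-variable-binomial i w z wz∈IA w≢z (λ r r∈ → gröbner-support i r (supp⊆ r r∈))

  gröbner-degree : ∀ i {k} → k ℕ.< weight (inject₁ i) → k ℕ.< degB (gröbner i)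
  gröbner-degree i k< = ℕ.<-≤-trans k< (ℕ.≤-trans (ℕ.≤-reflexive (≡.sym (deg-single (fromℕ K) _))) (ℕ.m≤n⊔m _ _))

  gröbner-term-degree : ∀ i {k} → k ℕ.< weight (inject₁ i) → DegPolyGT (binom (gröbner i)) k
  gröbner-term-degree i {k} k< = proj₂ (gröbner i) ,
    -1≉0 ∘ trans (sym (coeff-binom-right _ _ (gröbner-nontrivial i))) ,
    ≡.subst (k ℕ.<_) (≡.sym (deg-single (fromℕ K) _)) k<

theorem3p12 : ∀ {c ℓ : Level} (K : Field c ℓ) (f : ℕ → ℕ) →
    ∃[ n ] ∃[ m ] Σ (Config n m) λ A →
    (∀ i j → lookup A i ≡ lookup A j → i ≡ j) ×
    Σ (List (Binom m)) λ M →
    MarkovBasis K A M ×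
    DegGraverGT K A (f (degS M)) ×
    DegUniversalGT K A (f (degS M)) ×
    DegCircuitsGT K A (f (degS M))
theorem3p12 F f =
  1 , suc (suc N) , configuration (suc N) , configuration-injective (suc N) ,
  moves (suc N) , moves-markov ,
  (b₀ , gröbner-primitive zero , degree-b₀) ,
  (binom b₀ , gröbner-universal zero , gröbner-term-degree zero markov-degree-small) ,
  (b₀ , gröbner-circuit zero , degree-b₀)
  where
  open import Data.Nat using (suc; _<_; _^_)
  open import Data.Nat.Properties using (<-trans; n<1+n)
  open import Data.Fin using (zero)
  open import Data.Product using (_,_)
  open import Relation.Binary.PropositionalEquality using (cong; subst; sym)
  open PowersOfTwo

  N : ℕ
  N = f 2
  open PowersOfTwoIdeal F (suc N)
  open Polynomials F (suc (suc N)) using (binom)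

  b₀ : Binom (suc (suc N))
  b₀ = gröbner zero

  -- the moves have degree 2, and f 2 < 2^(N+1)
  markov-degree-small : f (degS (moves (suc N))) < 2 ^ suc N
  markov-degree-small = subst (_< 2 ^ suc N) (cong f (sym (degS-moves N))) (<-trans (n<1+n N) (n<2^n (suc N)))

  degree-b₀ : f (degS (moves (suc N))) < degB b₀
  degree-b₀ = gröbner-degree zero markov-degree-small
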